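{- Let $PR=\mathcal K(\mathbf L)$ be the Patras–Reutenauer Hopf algebra. For $\alpha\in\mathbf l[n]$, $$S(\alpha)=\sum_{\gamma\in\mathbf l[n]}(-1)^m\,d_{\alpha,\gamma}\,\gamma,$$ where $m=\ell(\epsilon\vee\gamma)$ and $d_{\alpha,\gamma}$ is the number of $\beta\in\mathbf l[n]$ such that, for $\Lambda=(\Lambda_1,\dots,\Lambda_m)=\beta\vee(\beta\circ\gamma)$: (i) $\beta$ is increasing with respect to $\epsilon$ within each part of $\Lambda$; (ii) $\beta\circ\gamma$ is increasing with respect to $\alpha$ within each part of $\Lambda$; (iii) for all $1\le i<m$, $\max_\epsilon(\Lambda_i)>_\epsilon\min_\epsilon(\Lambda_{i+1})$ or $\max_\alpha(\Lambda_i)>_\alpha\min_\alpha(\Lambda_{i+1})$.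
   Context: $\mathbf l[n]$ is the set of linear orders (words) $\beta=\beta_1\cdots\beta_n$ on $[n]=\{1,\dots,n\}$; $\epsilon=12\cdots n$. $PR=\bigoplus_{n\ge0}\Bbbk\,\mathbf l[n]$ is the graded Hopf algebra (over a field of characteristic $0$) with product $\alpha\cdot\alpha'=$ concatenation of $\alpha\in\mathbf l[n]$ with $\alpha'\in\mathbf l[n']$ shifted by $n$, and coproduct $\Delta(\alpha)=\sum_{S\subseteq[n]}\mathrm{st}(\alpha|_S)\otimes\mathrm{st}(\alpha|_{[n]\setminus S})$, where $\alpha|_S$ is the subword on $S$ and $\mathrm{st}$ relabels order-preservingly onto $\{1,\dots,|S|\}$; $S$ is its antipode. A word $\beta$ is also the permutation $i\mapsto\beta_i$, so $\beta\circ\gamma=\beta(\gamma_1)\cdots\beta(\gamma_n)$; a word $\beta$ is also identified with the set composition $(\{\beta_1\},\dots,\{\beta_n\})$ of $[n]$. A set composition $A=(A_1,\dots,A_k)$ is a sequence of nonempty disjoint sets with union $[n]$, $\ell(A)=k$; $A\le B$ if each part of $B$ is a union of consecutive parts of $A$. For words $\beta,\delta$, $\beta\vee\delta$ is the finest set composition $A$ with $\beta\le A$ and $\delta\le A$. "$\beta$ increasing with respect to $\epsilon$ within a part $P$" means the entries of $P$ appear in $\beta$ in increasing numerical order; "$\beta\circ\gamma$ increasing with respect to $\alpha$ within $P$" means the entries of $P$ appear in $\beta\circ\gamma$ in the same relative order as in $\alpha$. $<_\epsilon$ is the usual order and $<_\alpha$ is the order in which elements appear in the word $\alpha$; $\max_\epsilon,\min_\epsilon,\max_\alpha,\min_\alpha$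 are the extremes with respect to these orders. -}

module Defs where

open import Data.Nat using (ℕ; zero; suc; _+_; _<_; _<?_; _≟_)
open import Data.Integer as ℤ using (ℤ; +_; -_; _*_)
open import Data.List using (List; []; _∷_; _++_; map; filter; length; concatMap; upTo; concat; [_])
open import Data.List.Properties using (≡-dec)
open import Data.List.Membership.Propositional using (_∈_)
open import Data.List.Relation.Binary.Permutation.Propositional using (_↭_)
open import Data.List.Relation.Unary.All using (All)
open import Data.Product using (Σ; ∃; _×_; _,_)
open import Data.Sum using (_⊎_)
open import Data.Unit using (⊤)
open import Relation.Binary.PropositionalEquality using (_≡_; _≢_)
open import Relation.Nullary using (yes; no)

-- Words (linear orders on [n] = {1,…,n}) are lists of naturals.

range : ℕ → List ℕ
range n = map suc (upTo n)

ε : ℕ → List ℕ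
ε = range

IsWord : ℕ → List ℕ → Set
IsWord n w = w ↭ range n

st : List ℕ → List ℕ
st w = map (λ x → suc (length (filter (_<? x) w))) w

-- product of PR: concatenation with the second word shifted by |α|
_·_ : List ℕ → List ℕ → List ℕ
α · α' = α ++ map (_+ length α) α'

splits : List ℕ → List (List ℕ × List ℕ)
splits [] = ([] , []) ∷ []
splits (x ∷ xs) = concatMap (λ { (l , r) → (x ∷ l , r) ∷ (l , x ∷ r) ∷ [] }) (splits xs)

-- Elements of PR (over ℤ) as formal sums Σ c·w, and the antipode.

Elt : Set
Elt = List (ℤ × List ℕ)

negMul : List ℕ → Elt → Elt
negMul r = map (λ { (c , u) → (- c , u · r) })

-- antipode, defined by the defining recursion of the antipode of the
-- graded connected bialgebra PR:  m ∘ (S ⊗ id) ∘ Δ = η ∘ ε, i.e.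
--   S(∅) = ∅,   S(α) = - Σ_{S ⊊ [n]} S(st(α|_S)) · st(α|_{[n]∖S})  (n ≥ 1).
-- The first argument is fuel (≥ length of the word).
antipodeF : ℕ → List ℕ → Elt
antipodeF _ [] = (+ 1 , []) ∷ []
antipodeF zero (_ ∷ _) = []
antipodeF (suc k) (x ∷ xs) = concatMap term (splits (x ∷ xs))
  where
  term : List ℕ × List ℕ → Elt
  term (l , []) = []
  term (l , r@(_ ∷ _)) = negMul (st r) (antipodeF k (st l))

antipode : List ℕ → Elt
antipode w = antipodeF (length w) w

coeff : Elt → List ℕ → ℤ
coeff [] γ = + 0
coeff ((c , u) ∷ xs) γ with ≡-dec _≟_ u γ
... | yes _ = c ℤ.+ coeff xs γ
... | no _ = coeff xs γ

sgn : ℕ → ℤ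
sgn zero = + 1
sgn (suc m) = - sgn m

-- Composition of permutations: (β ∘ γ)_i = β(γ_i), where β(j) = β_j.

at : List ℕ → ℕ → ℕ
at [] _ = 0
at (x ∷ xs) zero = 0
at (x ∷ xs) (suc zero) = x
at (x ∷ xs) (suc (suc j)) = at xs (suc j)

compose : List ℕ → List ℕ → List ℕ
compose β γ = map (at β) γ

-- Set compositions: sequences of parts; a part is a list of its elements
-- (only the underlying set of a part matters below).

SetComp : Set
SetComp = List (List ℕ)

asComp : List ℕ → SetComp
asComp = map [_]

-- A ≤ B : each part of B is the union of a (nonempty) run of
-- consecutive parts of A, and these runs partition A in order.
data _≤C_ : SetComp → SetComp → Set where
  []≤ : [] ≤C []
  merge : ∀ {As rest b Bs} → As ≢ [] → concat As ↭ b → rest ≤C Bs →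
          (As ++ rest) ≤C (b ∷ Bs)

IsJoin : List ℕ → List ℕ → SetComp → Set
IsJoin β δ Λ = (asComp β ≤C Λ) × (asComp δ ≤C Λ) ×
               (∀ A → asComp β ≤C A → asComp δ ≤C A → Λ ≤C A)

Before : List ℕ → ℕ → ℕ → Set
Before w x y = Σ (List ℕ) λ u → Σ (List ℕ) λ v → (w ≡ u ++ x ∷ v) × (y ∈ v)

IncEps : List ℕ → List ℕ → Set
IncEps β P = ∀ {x y} → x ∈ P → y ∈ P → x < y → Before β x y

IncAlpha : List ℕ → List ℕ → List ℕ → Set
IncAlpha α w P = ∀ {x y} → x ∈ P → y ∈ P → Before α x y → Before w x y

-- max_ε(P) >_ε min_ε(Q)   (i.e. some element of P exceeds some element of Q)
MaxEpsGtMin : List ℕ → List ℕ → Set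
MaxEpsGtMin P Q = Σ ℕ λ x → Σ ℕ λ y → x ∈ P × y ∈ Q × y < x

-- max_α(P) >_α min_α(Q)   (i.e. some element of Q precedes some element of P in α)
MaxAlphaGtMin : List ℕ → List ℕ → List ℕ → Set
MaxAlphaGtMin α P Q = Σ ℕ λ x → Σ ℕ λ y → x ∈ P × y ∈ Q × Before α y x

Cond3 : List ℕ → List ℕ → List ℕ → Set
Cond3 α P Q = MaxEpsGtMin P Q ⊎ MaxAlphaGtMin α P Q

AllAdj : (List ℕ → List ℕ → Set) → SetComp → Set
AllAdj R [] = ⊤
AllAdj R (_ ∷ []) = ⊤
AllAdj R (P ∷ Q ∷ rest) = R P Q × AllAdj R (Q ∷ rest)

DCond : ℕ → List ℕ → List ℕ → List ℕ → Set
DCond n α γ β = IsWord n β × Σ SetComp λ Λ →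
  IsJoin β (compose β γ) Λ × All (IncEps β) Λ ×
  All (IncAlpha α (compose β γ)) Λ × AllAdj (Cond3 α) Λ

module Submission where

-- Every γ ∈ l[n] factors uniquely as γ = π₁ · ⋯ · πₘ into irreducible words, and ε ∨ γ is cut
-- exactly at the m factor boundaries.  Unfolding S(α) = − Σ_{S ⊊ [n]} S(st α|_S) · st α|_{[n]∖S},
-- a term contributes to the coefficient of γ only if its cut falls on a factor boundary, and
-- then by induction it counts decompositions of α into subwords B₁, …, Bₘ with st Bᵢ = πᵢ in
-- which no Bᵢ lies entirely before Bᵢ₊₁, both in value and in the order of α.  Grouping by the
-- last block, the resulting alternating sum telescopes to (−1)^m times the number of such
-- chains.  Sorting every block and concatenating is a bijection from chains onto the words β
-- counted by d_{α,γ}: β ∨ (β ∘ γ) is β cut at the factor boundaries of γ, condition (i) says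
-- the blocks of β are sorted, (ii) that the blocks of β ∘ γ are subwords of α, and (iii) that
-- no block precedes the next.

open import Defs
open import Data.Nat using (ℕ)
open import Data.Integer using (ℤ; +_; _*_)
open import Data.List using (List; length)
open import Data.List.Membership.Propositional using (_∈_)
open import Data.List.Relation.Unary.Unique.Propositional using (Unique)
open import Data.Product using (Σ; _×_)
open import Function.Bundles using (_⇔_)
open import Relation.Nullary using (¬_)
open import Relation.Binary.PropositionalEquality using (_≡_)

open import Data.Nat as ℕ using (zero; suc; _≤_; _<_; z≤n; s≤s; _<?_; _≟_; _≤?_; _∸_)
open import Data.Nat.Properties as ℕP using ()
open import Data.Integer using (-_) renaming (_+_ to _+ᶻ_)
open import Data.Integer.Properties as ℤP using ()
open import Algebra.Properties.CommutativeSemigroup ℤP.+-commutativeSemigroup using () renaming (interchange to +-interchange)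
open import Data.List using ([]; _∷_; _++_; map; filter; concatMap; concat; take; drop; [_]; upTo; applyUpTo; reverse)
open import Data.List.Properties as LP using (≡-dec)
open import Data.List.Relation.Unary.All as All using (All; []; _∷_)
open import Data.List.Relation.Unary.All.Properties as AllP using ()
open import Data.List.Relation.Unary.AllPairs as AP using (AllPairs; []; _∷_)
open import Data.List.Relation.Unary.AllPairs.Properties as APP using ()
open import Data.List.Relation.Unary.Any as Any using (Any; here; there)
open import Data.List.Relation.Unary.Any.Properties as AnyP using ()
open import Data.List.Relation.Unary.Linked.Properties using (Linked⇒AllPairs)
open import Data.List.Relation.Unary.Unique.Propositional.Properties as UP using ()
open import Data.List.Relation.Binary.Disjoint.Propositional using (Disjoint)
open import Data.List.Membership.Propositional using (_∉_)
open import Data.List.Membership.Propositional.Properties using (∈-map⁺; ∈-map⁻; ∈-++⁻; ∈-++⁺ˡ; ∈-++⁺ʳ; ∈-filter⁺; ∈-filter⁻; ∈-∃++; ∈-upTo⁺; ∈-upTo⁻)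
open import Data.List.Membership.Propositional.Properties.WithK using (unique∧set⇒bag)
open import Data.List.Membership.DecPropositional ℕP._≟_ using (_∈?_)
open import Data.List.Relation.Binary.BagAndSetEquality using (∼bag⇒↭)
open import Data.List.Relation.Binary.Pointwise as Pw using (Pointwise; []; _∷_)
open import Data.List.Relation.Binary.Permutation.Propositional using (_↭_; ↭-sym; ↭-trans; ↭-refl)
open import Data.List.Relation.Ternary.Interleaving.Propositional {A = ℕ} using (Interleaving; []; consˡ; consʳ; toPermutation)
open import Data.List.Relation.Ternary.Interleaving.Properties using (interleave-length)
open import Data.List.Relation.Binary.Permutation.Propositional.Properties as PP using ()
open import Data.List.Sort ℕP.≤-decTotalOrder using (sort; sort-↭; sort-↗)
open import Data.Maybe using (Maybe; just; nothing)
open import Data.Product using (_,_; proj₁; proj₂)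
open import Data.Sum using (_⊎_; inj₁; inj₂; [_,_]′)
open import Data.Unit using (tt)
open import Data.Empty using (⊥; ⊥-elim)
open import Function using (_∘_)
open import Function.Bundles using (mk⇔)
open import Relation.Nullary using (Dec; yes; no)
open import Relation.Nullary.Decidable using (_×-dec_; ¬?)
open import Relation.Binary.Definitions using (tri<; tri≈; tri>)
open import Relation.Binary.PropositionalEquality using (_≢_; refl; sym; trans; cong; cong₂; subst; subst₂; module ≡-Reasoning)

-- Sums over the splittings of a word

Σsplits : List ℕ → (List ℕ → List ℕ → ℤ) → ℤ
Σsplits [] f = f [] []
Σsplits (x ∷ xs) f = Σsplits xs (λ l r → f (x ∷ l) r +ᶻ f l (x ∷ r))

concatSplits : ∀ {A : Set} → List ℕ → (List ℕ → List ℕ → List A) → List A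
concatSplits [] f = f [] []
concatSplits (x ∷ xs) f = concatSplits xs (λ l r → f (x ∷ l) r ++ f l (x ∷ r))

Σsplits-cong : ∀ w {f g : List ℕ → List ℕ → ℤ} → (∀ {l r} → Interleaving l r w → f l r ≡ g l r) → Σsplits w f ≡ Σsplits w g
Σsplits-cong [] eq = eq []
Σsplits-cong (x ∷ xs) eq = Σsplits-cong xs (λ i → cong₂ _+ᶻ_ (eq (consˡ i)) (eq (consʳ i)))

concatSplits-cong : ∀ {A : Set} w {f g : List ℕ → List ℕ → List A} → (∀ {l r} → Interleaving l r w → f l r ≡ g l r) → concatSplits w f ≡ concatSplits w g
concatSplits-cong [] eq = eq []
concatSplits-cong (x ∷ xs) eq = concatSplits-cong xs (λ i → cong₂ _++_ (eq (consˡ i)) (eq (consʳ i)))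

Σsplits-+ : ∀ w (f g : List ℕ → List ℕ → ℤ) → Σsplits w (λ l r → f l r +ᶻ g l r) ≡ Σsplits w f +ᶻ Σsplits w g
Σsplits-+ [] f g = refl
Σsplits-+ (x ∷ xs) f g = trans (Σsplits-cong xs (λ {l} {r} _ → +-interchange (f (x ∷ l) r) (g (x ∷ l) r) (f l (x ∷ r)) (g l (x ∷ r))))
  (Σsplits-+ xs (λ l r → f (x ∷ l) r +ᶻ f l (x ∷ r)) (λ l r → g (x ∷ l) r +ᶻ g l (x ∷ r)))

Σsplits-* : ∀ w c (f : List ℕ → List ℕ → ℤ) → Σsplits w (λ l r → c * f l r) ≡ c * Σsplits w f
Σsplits-* [] c f = refl
Σsplits-* (x ∷ xs) c f = trans (Σsplits-cong xs (λ {l} {r} _ → sym (ℤP.*-distribˡ-+ c (f (x ∷ l) r) (f l (x ∷ r)))))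
  (Σsplits-* xs c (λ l r → f (x ∷ l) r +ᶻ f l (x ∷ r)))

Σsplits-neg : ∀ w (f : List ℕ → List ℕ → ℤ) → Σsplits w (λ l r → - f l r) ≡ - Σsplits w f
Σsplits-neg w f = trans (Σsplits-cong w (λ {l} {r} _ → sym (ℤP.-1*i≡-i (f l r)))) (trans (Σsplits-* w (- + 1) f) (ℤP.-1*i≡-i (Σsplits w f)))

Σsplits-0 : ∀ w → Σsplits w (λ _ _ → + 0) ≡ + 0
Σsplits-0 [] = refl
Σsplits-0 (x ∷ xs) = Σsplits-0 xs

Σsplits-coassoc : ∀ w (F : List ℕ → List ℕ → List ℕ → ℤ) →
  Σsplits w (λ l r → Σsplits l (λ a b → F a b r)) ≡ Σsplits w (λ a r' → Σsplits r' (λ b r → F a b r))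
Σsplits-coassoc [] F = refl
Σsplits-coassoc (x ∷ xs) F =
  trans (Σsplits-cong xs (λ {l} {r} _ →
     sym (Σsplits-+ l (λ a b → F (x ∷ a) b r +ᶻ F a (x ∷ b) r) (λ a b → F a b (x ∷ r)))))
  (trans (Σsplits-coassoc xs (λ a b r → (F (x ∷ a) b r +ᶻ F a (x ∷ b) r) +ᶻ F a b (x ∷ r)))
   (Σsplits-cong xs (λ {a} {r'} _ → trans (Σsplits-cong r' (λ {b} {r} _ → ℤP.+-assoc (F (x ∷ a) b r) (F a (x ∷ b) r) (F a b (x ∷ r))))
      (Σsplits-+ r' (λ b r → F (x ∷ a) b r) (λ b r → F a (x ∷ b) r +ᶻ F a b (x ∷ r))))))

length-concatSplits : ∀ {A : Set} w (f : List ℕ → List ℕ → List A) → + length (concatSplits w f) ≡ Σsplits w (λ l r → + length (f l r))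
length-concatSplits [] f = refl
length-concatSplits (x ∷ xs) f = trans (length-concatSplits xs (λ l r → f (x ∷ l) r ++ f l (x ∷ r)))
  (Σsplits-cong xs (λ {l} {r} _ → trans (cong +_ (LP.length-++ (f (x ∷ l) r))) (ℤP.pos-+ (length (f (x ∷ l) r)) (length (f l (x ∷ r))))))

splitsStep : ℕ → List ℕ × List ℕ → List (List ℕ × List ℕ)
splitsStep x (l , r) = (x ∷ l , r) ∷ (l , x ∷ r) ∷ []

concatMap-concatMap : ∀ {A B C : Set} (g : B → List C) (h : A → List B) xs →
  concatMap g (concatMap h xs) ≡ concatMap (λ a → concatMap g (h a)) xs
concatMap-concatMap g h [] = refl
concatMap-concatMap g h (x ∷ xs) = trans (LP.concatMap-++ g (h x) (concatMap h xs)) (cong (concatMap g (h x) ++_) (concatMap-concatMap g h xs))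

concatMap-splits : ∀ {A : Set} w (g : List ℕ × List ℕ → List A) → concatMap g (splits w) ≡ concatSplits w (λ l r → g (l , r))
concatMap-splits [] g = LP.++-identityʳ (g ([] , []))
concatMap-splits (x ∷ xs) g =
  trans (concatMap-concatMap g (splitsStep x) (splits xs))
  (trans (LP.concatMap-cong (λ { (l , r) → cong (g (x ∷ l , r) ++_) (LP.++-identityʳ (g (l , x ∷ r))) }) (splits xs))
   (concatMap-splits xs (λ p → g (x ∷ proj₁ p , proj₂ p) ++ g (proj₁ p , x ∷ proj₂ p))))

when : ∀ {P : Set} → Dec P → ℤ → ℤ
when (yes _) a = a
when (no _) a = + 0

unless : ∀ {P : Set} → Dec P → ℤ → ℤ
unless (yes _) a = + 0
unless (no _) a = a

coeff-++ : ∀ a b γ → coeff (a ++ b) γ ≡ coeff a γ +ᶻ coeff b γ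
coeff-++ [] b γ = sym (ℤP.+-identityˡ _)
coeff-++ ((c , u) ∷ a) b γ with ≡-dec _≟_ u γ
... | yes _ = trans (cong (c +ᶻ_) (coeff-++ a b γ)) (sym (ℤP.+-assoc c _ _))
... | no _ = coeff-++ a b γ

coeff-concatSplits : ∀ w (f : List ℕ → List ℕ → Elt) γ → coeff (concatSplits w f) γ ≡ Σsplits w (λ l r → coeff (f l r) γ)
coeff-concatSplits [] f γ = refl
coeff-concatSplits (x ∷ xs) f γ = trans (coeff-concatSplits xs (λ l r → f (x ∷ l) r ++ f l (x ∷ r)) γ)
  (Σsplits-cong xs (λ {l} {r} _ → coeff-++ (f (x ∷ l) r) (f l (x ∷ r)) γ))

All-concatSplits : ∀ {A : Set} {P : A → Set} w (f : List ℕ → List ℕ → List A) → (∀ {l r} → Interleaving l r w → All P (f l r)) → All P (concatSplits w f)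
All-concatSplits [] f h = h []
All-concatSplits (x ∷ xs) f h = All-concatSplits xs _ (λ i → AllP.++⁺ (h (consˡ i)) (h (consʳ i)))

concatSplits-map : ∀ {A : Set} (g : ℕ → ℕ) w (F : List ℕ → List ℕ → List A) → concatSplits (map g w) F ≡ concatSplits w (λ l r → F (map g l) (map g r))
concatSplits-map g [] F = refl
concatSplits-map g (x ∷ xs) F = concatSplits-map g xs _

interleaving-∈ˡ : ∀ {l r w x} → Interleaving l r w → x ∈ l → x ∈ w
interleaving-∈ˡ (consˡ i) (here p) = here p
interleaving-∈ˡ (consˡ i) (there m) = there (interleaving-∈ˡ i m)
interleaving-∈ˡ (consʳ i) m = there (interleaving-∈ˡ i m)

interleaving-∈ʳ : ∀ {l r w x} → Interleaving l r w → x ∈ r → x ∈ w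
interleaving-∈ʳ (consʳ i) (here p) = here p
interleaving-∈ʳ (consʳ i) (there m) = there (interleaving-∈ʳ i m)
interleaving-∈ʳ (consˡ i) m = there (interleaving-∈ʳ i m)

antipodeTerm : ℕ → List ℕ → List ℕ → Elt
antipodeTerm k l [] = []
antipodeTerm k l r@(_ ∷ _) = negMul (st r) (antipodeF k (st l))

-- The local function term of antipodeF cannot be named here, so it is abstracted
-- as g and pinned down by its two defining equations.
antipodeF-suc : ∀ k x xs → antipodeF (suc k) (x ∷ xs) ≡ concatSplits (x ∷ xs) (antipodeTerm k)
antipodeF-suc k x xs = unfold _ (λ _ → refl) (λ _ _ _ → refl)
  where
  unfold : (g : List ℕ × List ℕ → Elt) → (∀ l → g (l , []) ≡ []) →
           (∀ l y ys → g (l , y ∷ ys) ≡ antipodeTerm k l (y ∷ ys)) →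
           concatMap g (splits (x ∷ xs)) ≡ concatSplits (x ∷ xs) (antipodeTerm k)
  unfold g g[] g∷ = trans (concatMap-splits (x ∷ xs) g) (concatSplits-cong (x ∷ xs) g≡term)
    where
    g≡term : ∀ {l r} → Interleaving l r (x ∷ xs) → g (l , r) ≡ antipodeTerm k l r
    g≡term {l} {[]} _ = g[] l
    g≡term {l} {y ∷ ys} _ = g∷ l y ys

length-st : ∀ w → length (st w) ≡ length w
length-st w = LP.length-map _ w

length-· : ∀ u s → length (u · s) ≡ length u ℕ.+ length s
length-· u s = trans (LP.length-++ u) (cong (length u ℕ.+_) (LP.length-map _ s))

antipodeF-lengths : ∀ k w → All (λ e → length (proj₂ e) ≡ length w) (antipodeF k w)
antipodeF-lengths _ [] = refl ∷ []
antipodeF-lengths zero (_ ∷ _) = []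
antipodeF-lengths (suc k) (x ∷ xs) =
  subst (All _) (sym (antipodeF-suc k x xs)) (All-concatSplits (x ∷ xs) _ term-lengths)
  where
  term-lengths : ∀ {l r} → Interleaving l r (x ∷ xs) → All (λ e → length (proj₂ e) ≡ length (x ∷ xs)) (antipodeTerm k l r)
  term-lengths {l} {[]} _ = []
  term-lengths {l} {r@(_ ∷ _)} i = AllP.map⁺ (All.map (λ {(c , u)} |u|≡ → begin
      length (u · st r)             ≡⟨ length-· u (st r) ⟩
      length u ℕ.+ length (st r)    ≡⟨ cong₂ ℕ._+_ (trans |u|≡ (length-st l)) (length-st r) ⟩
      length l ℕ.+ length r         ≡⟨ sym (interleave-length i) ⟩
      length (x ∷ xs)               ∎) (antipodeF-lengths k (st l)))
    where open ≡-Reasoning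

take-length-++ : ∀ (u v : List ℕ) → take (length u) (u ++ v) ≡ u
take-length-++ [] v = refl
take-length-++ (x ∷ u) v = cong (x ∷_) (take-length-++ u v)

drop-length-++ : ∀ (u v : List ℕ) → drop (length u) (u ++ v) ≡ v
drop-length-++ [] v = refl
drop-length-++ (x ∷ u) v = drop-length-++ u v

cutTerm : (List ℕ → ℤ) → ℕ → List ℕ → List ℕ → ℤ
cutTerm X L s γ = when (≡-dec _≟_ (map (ℕ._+ L) s) (drop L γ)) (- X (take L γ))

coeff-negMul : ∀ s (X : Elt) L γ → All (λ e → length (proj₂ e) ≡ L) X →
  coeff (negMul s X) γ ≡ cutTerm (coeff X) L s γ
coeff-negMul s [] L γ [] with ≡-dec _≟_ (map (ℕ._+ L) s) (drop L γ)
... | yes _ = refl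
... | no _ = refl
coeff-negMul s ((c , u) ∷ X) L γ (refl ∷ ps) with ≡-dec _≟_ (map (ℕ._+ length u) s) (drop (length u) γ) | coeff-negMul s X (length u) γ ps
... | yes m | ih with ≡-dec _≟_ (u · s) γ | ≡-dec _≟_ u (take (length u) γ)
...   | yes e | yes e' = trans (cong (- c +ᶻ_) ih) (sym (ℤP.neg-distrib-+ c _))
...   | yes e | no ne = ⊥-elim (ne (trans (sym (take-length-++ u _)) (cong (take (length u)) e)))
...   | no ne | yes e' = ⊥-elim (ne (trans (cong (_++ map (ℕ._+ length u) s) e') (trans (cong (take (length u) γ ++_) m) (LP.take++drop≡id (length u) γ))))
...   | no ne | no _ = ih
coeff-negMul s ((c , u) ∷ X) L γ (refl ∷ ps) | no ¬m | ih with ≡-dec _≟_ (u · s) γ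
... | yes e = ⊥-elim (¬m (trans (sym (drop-length-++ u _)) (cong (drop (length u)) e)))
... | no _ = ih

-- Standardisation

countLt : ℕ → List ℕ → ℕ
countLt x [] = 0
countLt x (y ∷ ys) with y <? x
... | yes _ = suc (countLt x ys)
... | no _ = countLt x ys

length-filter-< : ∀ x w → length (filter (_<? x) w) ≡ countLt x w
length-filter-< x [] = refl
length-filter-< x (y ∷ ys) with y <? x
... | yes p = trans (cong length (LP.filter-accept (_<? x) p)) (cong suc (length-filter-< x ys))
... | no ¬p = trans (cong length (LP.filter-reject (_<? x) ¬p)) (length-filter-< x ys)

rank : List ℕ → ℕ → ℕ
rank w x = suc (length (filter (_<? x) w))

rank≡suc-countLt : ∀ w x → rank w x ≡ suc (countLt x w)
rank≡suc-countLt w x = cong suc (length-filter-< x w)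

countLt-mono : ∀ {a b} w → a ≤ b → countLt a w ≤ countLt b w
countLt-mono [] le = z≤n
countLt-mono {a} {b} (y ∷ ys) le with y <? a | y <? b
... | yes _ | yes _ = s≤s (countLt-mono ys le)
... | yes p | no ¬q = ⊥-elim (¬q (ℕP.<-≤-trans p le))
... | no _ | yes _ = ℕP.m≤n⇒m≤1+n (countLt-mono ys le)
... | no _ | no _ = countLt-mono ys le

countLt-strict : ∀ {a b} w → a < b → a ∈ w → suc (countLt a w) ≤ countLt b w
countLt-strict {a} {b} (y ∷ ys) lt m with y <? a | y <? b
countLt-strict {a} {b} (y ∷ ys) lt (here refl) | yes p | _ = ⊥-elim (ℕP.<-irrefl refl p)
countLt-strict {a} {b} (y ∷ ys) lt (here refl) | no _ | yes _ = s≤s (countLt-mono ys (ℕP.<⇒≤ lt))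
countLt-strict {a} {b} (y ∷ ys) lt (here refl) | no _ | no ¬q = ⊥-elim (¬q lt)
countLt-strict {a} {b} (y ∷ ys) lt (there m) | yes _ | yes _ = s≤s (countLt-strict ys lt m)
countLt-strict {a} {b} (y ∷ ys) lt (there m) | yes p | no ¬q = ⊥-elim (¬q (ℕP.<-trans p lt))
countLt-strict {a} {b} (y ∷ ys) lt (there m) | no _ | yes _ = ℕP.m≤n⇒m≤1+n (countLt-strict ys lt m)
countLt-strict {a} {b} (y ∷ ys) lt (there m) | no _ | no _ = countLt-strict ys lt m

rank-mono-< : ∀ {a b} w → a ∈ w → a < b → rank w a < rank w b
rank-mono-< {a} {b} w m lt = subst₂' (rank≡suc-countLt w a) (rank≡suc-countLt w b) (s≤s (countLt-strict w lt m))
  where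
  subst₂' : ∀ {x y x' y'} → x ≡ x' → y ≡ y' → x' < y' → x < y
  subst₂' refl refl p = p

rank-mono-≤ : ∀ {a b} w → b ≤ a → rank w b ≤ rank w a
rank-mono-≤ {a} {b} w le rewrite rank≡suc-countLt w a | rank≡suc-countLt w b = s≤s (countLt-mono w le)

rank-cancel-< : ∀ {a b} w → rank w a < rank w b → a < b
rank-cancel-< {a} {b} w lt with a <? b
... | yes p = p
... | no ¬p = ⊥-elim (ℕP.<⇒≱ lt (rank-mono-≤ w (ℕP.≮⇒≥ ¬p)))

countLt-map : ∀ (f : ℕ → ℕ) x v → (∀ {y} → y ∈ v → (y < x → f y < f x) × (f y < f x → y < x)) → countLt (f x) (map f v) ≡ countLt x v
countLt-map f x [] h = refl
countLt-map f x (y ∷ ys) h with f y <? f x | y <? x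
... | yes _ | yes _ = cong suc (countLt-map f x ys (λ m → h (there m)))
... | yes p | no ¬q = ⊥-elim (¬q (proj₂ (h (here refl)) p))
... | no ¬p | yes q = ⊥-elim (¬p (proj₁ (h (here refl)) q))
... | no _ | no _ = countLt-map f x ys (λ m → h (there m))

st-map-monotone : ∀ (f : ℕ → ℕ) v → (∀ {a b} → a ∈ v → b ∈ v → (a < b → f a < f b) × (f a < f b → a < b)) → st (map f v) ≡ st v
st-map-monotone f v h = trans (sym (LP.map-∘ v)) (LP.map-cong-local (All.tabulate rank-map))
  where
  rank-map : ∀ {x} → x ∈ v → rank (map f v) (f x) ≡ rank v x
  rank-map {x} m = trans (rank≡suc-countLt (map f v) (f x)) (trans (cong suc (countLt-map f x v (λ m' → h m' m))) (sym (rank≡suc-countLt v x)))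

antipodeF-st : ∀ k w → antipodeF k (st w) ≡ antipodeF k w
antipodeF-st k [] = refl
antipodeF-st zero (y ∷ ys) = refl
antipodeF-st (suc k) (y ∷ ys) = begin
  antipodeF (suc k) (map f w)                                     ≡⟨ antipodeF-suc k (f y) (map f ys) ⟩
  concatSplits (map f w) (antipodeTerm k)                         ≡⟨ concatSplits-map f w (antipodeTerm k) ⟩
  concatSplits w (λ l r → antipodeTerm k (map f l) (map f r))     ≡⟨ concatSplits-cong w term-st ⟩
  concatSplits w (antipodeTerm k)                                 ≡⟨ sym (antipodeF-suc k y ys) ⟩
  antipodeF (suc k) w                                             ∎
  where
  open ≡-Reasoning
  w = y ∷ ys
  f = rank w
  st-map-rank : ∀ {v} → (∀ {x} → x ∈ v → x ∈ w) → st (map f v) ≡ st v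
  st-map-rank sub = st-map-monotone f _ (λ ma mb → rank-mono-< w (sub ma) , rank-cancel-< w)
  term-st : ∀ {l r} → Interleaving l r w → antipodeTerm k (map f l) (map f r) ≡ antipodeTerm k l r
  term-st {l} {[]} i = refl
  term-st {l} {_ ∷ _} i =
    cong₂ (λ s t → negMul s (antipodeF k t)) (st-map-rank (interleaving-∈ʳ i)) (st-map-rank (interleaving-∈ˡ i))

-- Products of words and cuts at factor boundaries

-- prodRev [q₁, …, qₘ] = qₘ · ⋯ · q₁: the antipode recursion splits off the last factor.
sizeRev : List (List ℕ) → ℕ
sizeRev [] = 0
sizeRev (q ∷ qs) = sizeRev qs ℕ.+ length q

prodRev : List (List ℕ) → List ℕ
prodRev [] = []
prodRev (q ∷ qs) = prodRev qs · q

length-prodRev : ∀ qs → length (prodRev qs) ≡ sizeRev qs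
length-prodRev [] = refl
length-prodRev (q ∷ qs) = trans (length-· (prodRev qs) q) (cong (ℕ._+ length q) (length-prodRev qs))

map-+0 : ∀ (q : List ℕ) → map (ℕ._+ 0) q ≡ q
map-+0 q = LP.map-id-local (All.tabulate (λ {x} _ → ℕP.+-identityʳ x))

[]·_ : ∀ q → [] · q ≡ q
[]· q = map-+0 q

·[] : ∀ q → q · [] ≡ q
·[] q = LP.++-identityʳ q

·-assoc : ∀ a b c → (a · b) · c ≡ a · (b · c)
·-assoc a b c = trans (LP.++-assoc a (map (ℕ._+ length a) b) _)
  (cong (a ++_) (trans (cong (map (ℕ._+ length a) b ++_) shift-shift) (sym (LP.map-++ (ℕ._+ length a) b _))))
  where
  shift-shift : map (ℕ._+ length (a · b)) c ≡ map (ℕ._+ length a) (map (ℕ._+ length b) c)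
  shift-shift = trans (LP.map-cong shift-length c)
        (LP.map-∘ c)
    where
    shift-length : ∀ x → x ℕ.+ length (a · b) ≡ (x ℕ.+ length b) ℕ.+ length a
    shift-length x = trans (cong (x ℕ.+_) (trans (length-· a b) (ℕP.+-comm (length a) (length b)))) (sym (ℕP.+-assoc x (length b) (length a)))

prodRev-∷ʳ : ∀ t q → prodRev (t ++ [ q ]) ≡ q · prodRev t
prodRev-∷ʳ [] q = trans ([]· q) (sym (·[] q))
prodRev-∷ʳ (x ∷ t) q = trans (cong (_· x) (prodRev-∷ʳ t q)) (·-assoc q (prodRev t) x)

AllBelow : List ℕ → List ℕ → Set
AllBelow w r = All (λ x → All (x <_) r) w

countLt-++ : ∀ x a b → countLt x (a ++ b) ≡ countLt x a ℕ.+ countLt x b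
countLt-++ x [] b = refl
countLt-++ x (y ∷ a) b with y <? x
... | yes _ = cong suc (countLt-++ x a b)
... | no _ = countLt-++ x a b

countLt-none : ∀ x b → All (x <_) b → countLt x b ≡ 0
countLt-none x [] _ = refl
countLt-none x (y ∷ b) (p ∷ ps) with y <? x
... | yes q = ⊥-elim (ℕP.<-asym p q)
... | no _ = countLt-none x b ps

countLt-all : ∀ x a → All (_< x) a → countLt x a ≡ length a
countLt-all x [] _ = refl
countLt-all x (y ∷ a) (p ∷ ps) with y <? x
... | yes _ = cong suc (countLt-all x a ps)
... | no ¬q = ⊥-elim (¬q p)

st-++ : ∀ w r → AllBelow w r → st (w ++ r) ≡ st w · st r
st-++ w r w<r = trans (LP.map-++ (rank (w ++ r)) w r)
  (cong₂ _++_ (LP.map-cong-local (All.tabulate rank-left))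
     (trans (LP.map-cong-local (All.tabulate rank-right)) (LP.map-∘ r)))
  where
  rank-left : ∀ {x} → x ∈ w → rank (w ++ r) x ≡ rank w x
  rank-left {x} m = trans (rank≡suc-countLt (w ++ r) x) (trans (cong suc (trans (countLt-++ x w r)
      (trans (cong (countLt x w ℕ.+_) (countLt-none x r (All.lookup w<r m))) (ℕP.+-identityʳ _)))) (sym (rank≡suc-countLt w x)))
  rank-right : ∀ {y} → y ∈ r → rank (w ++ r) y ≡ rank r y ℕ.+ length (st w)
  rank-right {y} m = trans (rank≡suc-countLt (w ++ r) y) (trans (cong suc (trans (countLt-++ y w r)
     (trans (cong (ℕ._+ countLt y r) (countLt-all y w (All.map (λ ps → All.lookup ps m) w<r))) (ℕP.+-comm (length w) (countLt y r)))))
     (cong₂ ℕ._+_ (sym (rank≡suc-countLt r y)) (sym (length-st w))))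

++-cancel-length : ∀ (a b c d : List ℕ) → a ++ b ≡ c ++ d → length a ≡ length c → a ≡ c × b ≡ d
++-cancel-length [] b [] d e _ = refl , e
++-cancel-length (x ∷ a) b (y ∷ c) d e l with LP.∷-injective e
... | refl , e' with ++-cancel-length a b c d e' (ℕP.suc-injective l)
... | refl , e'' = refl , e''

+-inj : ∀ k → ∀ {x y} → x ℕ.+ k ≡ y ℕ.+ k → x ≡ y
+-inj k {x} {y} e = ℕP.+-cancelʳ-≡ k x y e

st-++⁻ : ∀ w r q P → length w ≡ length q → All (λ x → x ≤ length q) q → All (1 ≤_) P →
   st (w ++ r) ≡ q · P → AllBelow w r × st w ≡ q × st r ≡ P
st-++⁻ w r q P |w| q≤ P≥1 st≡ = w<r , st-w , LP.map-injective (+-inj (length q)) (trans (cong (λ z → map (ℕ._+ z) (st r)) (sym (trans (length-st w) |w|))) st-r)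
  where
  rk = rank (w ++ r)
  ranks-split = ++-cancel-length (map rk w) (map rk r) q (map (ℕ._+ length q) P) (trans (sym (LP.map-++ rk w r)) st≡) (trans (LP.length-map rk w) |w|)
  w<r : AllBelow w r
  w<r = All.tabulate (λ {x} mx → All.tabulate (λ {y} my → rank-cancel-< (w ++ r)
        (ℕP.≤-<-trans (All.lookup q≤ (subst (rk x ∈_) (proj₁ ranks-split) (∈-map⁺ rk mx)))
          (above-q (subst (rk y ∈_) (proj₂ ranks-split) (∈-map⁺ rk my))))))
    where
    above-q : ∀ {z} → z ∈ map (ℕ._+ length q) P → length q < z
    above-q {z} m with ∈-map⁻ (ℕ._+ length q) m
    ... | u , mu , eq = subst (length q <_) (sym eq) (ℕP.+-monoˡ-≤ (length q) (All.lookup P≥1 mu))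
  st-split = ++-cancel-length (st w) (map (ℕ._+ length (st w)) (st r)) q (map (ℕ._+ length q) P) (trans (sym (st-++ w r w<r)) st≡) (trans (length-st w) |w|)
  st-w = proj₁ st-split
  st-r = proj₂ st-split

-- The irreducible words are the factors of the unique factorisation into ·: permutations of
-- [|q|] (given Unique q) in which no proper prefix of length i is a permutation of [i].
Irreducible : List ℕ → Set
Irreducible q = (0 < length q) × All (λ x → 1 ≤ x × x ≤ length q) q × (∀ i → 0 < i → i < length q → Any (_≤ i) (drop i q))

All-≥1-mapSuc : ∀ (g : ℕ → ℕ) xs → All (1 ≤_) (map (λ x → suc (g x)) xs)
All-≥1-mapSuc g [] = []
All-≥1-mapSuc g (x ∷ xs) = s≤s z≤n ∷ All-≥1-mapSuc g xs

st-positive : ∀ s → All (1 ≤_) (st s)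
st-positive s = All-≥1-mapSuc (λ x → length (filter (_<? x) s)) s

prodRev-positive : ∀ t → All Irreducible t → All (1 ≤_) (prodRev t)
prodRev-positive [] _ = []
prodRev-positive (q ∷ t) (iq ∷ it) = AllP.++⁺ (prodRev-positive t it) (AllP.map⁺ (All.map (λ {x} p → ℕP.≤-trans (proj₁ p) (ℕP.m≤m+n x _)) (proj₁ (proj₂ iq))))

drop-length-+ : ∀ (a v : List ℕ) i → drop (length a ℕ.+ i) (a ++ v) ≡ drop i v
drop-length-+ [] v i = refl
drop-length-+ (x ∷ a) v i = drop-length-+ a v i

drop-++-short : ∀ i (q X : List ℕ) → i ≤ length q → drop i (q ++ X) ≡ drop i q ++ X
drop-++-short zero q X _ = refl
drop-++-short (suc i) (x ∷ q) X (s≤s le) = drop-++-short i q X le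

Any-All-contradiction : ∀ {P Q : ℕ → Set} {xs} → Any P xs → All Q xs → (∀ {x} → P x → Q x → ⊥) → ⊥
Any-All-contradiction (here p) (q ∷ _) f = f p q
Any-All-contradiction (there a) (_ ∷ qs) f = Any-All-contradiction a qs f

-- A standardised word shifted by L has all entries > L, whereas cutting an irreducible
-- factor strictly inside leaves an entry ≤ L behind the cut.
irreducible-uncut : ∀ a q b s L → Irreducible q → length a < L → L < length a ℕ.+ length q →
  map (ℕ._+ L) (st s) ≢ drop L (a · (q · b))
irreducible-uncut a q b s L (_ , _ , irr) a<L L<aq e = Any-All-contradiction entry≤L entries>L (λ le lt → ℕP.<⇒≱ lt le)
  where
  i = L ∸ length a
  L≡a+i : L ≡ length a ℕ.+ i
  L≡a+i = sym (ℕP.m+[n∸m]≡n (ℕP.<⇒≤ a<L))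
  i<q : i < length q
  i<q = ℕP.+-cancelˡ-< (length a) i (length q) (subst (_< length a ℕ.+ length q) L≡a+i L<aq)
  entries>L : All (L <_) (map (ℕ._+ L) (st s))
  entries>L = AllP.map⁺ (All.map (λ {x} p → ℕP.+-monoˡ-≤ L p) (st-positive s))
  tail≡ : drop L (a · (q · b)) ≡ map (ℕ._+ length a) (drop i q) ++ _
  tail≡ = trans (cong (λ m → drop m (a · (q · b))) L≡a+i)
    (trans (drop-length-+ a _ i) (trans (LP.drop-map i (q · b))
      (trans (cong (map (ℕ._+ length a)) (drop-++-short i q _ (ℕP.<⇒≤ i<q))) (LP.map-++ _ (drop i q) _))))
  small : Any (_≤ L) (map (ℕ._+ length a) (drop i q))
  small = AnyP.map⁺ (Any.map (λ {x} x≤i → subst (x ℕ.+ length a ≤_) (trans (ℕP.+-comm i (length a)) (sym L≡a+i)) (ℕP.+-monoˡ-≤ (length a) x≤i))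
    (irr i (ℕP.m<n⇒0<n∸m a<L) i<q))
  entry≤L : Any (_≤ L) (map (ℕ._+ L) (st s))
  entry≤L = subst (Any (_≤ L)) (sym (trans e tail≡)) (AnyP.++⁺ˡ small)

when-iff : ∀ {P Q : Set} (d : Dec P) (d' : Dec Q) a → (P → Q) → (Q → P) → when d a ≡ when d' a
when-iff (yes p) (yes q) a f g = refl
when-iff (yes p) (no ¬q) a f g = ⊥-elim (¬q (f p))
when-iff (no ¬p) (yes q) a f g = ⊥-elim (¬p (g q))
when-iff (no ¬p) (no ¬q) a f g = refl

when-no : ∀ {P : Set} (d : Dec P) a → ¬ P → when d a ≡ + 0
when-no (yes p) a ¬p = ⊥-elim (¬p p)
when-no (no _) a ¬p = refl

st≟prodRev : ∀ r t → Dec (st r ≡ prodRev t)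
st≟prodRev r t = ≡-dec _≟_ (st r) (prodRev t)

cutSum : (List ℕ → ℤ) → List ℕ → List (List ℕ) → List (List ℕ) → ℤ
cutSum X r t [] = when (st≟prodRev r t) (- X [])
cutSum X r t (q ∷ h) = when (st≟prodRev r t) (- X (prodRev (q ∷ h))) +ᶻ cutSum X r (t ++ [ q ]) h

sizeRev-∷ʳ : ∀ t q → sizeRev (t ++ [ q ]) ≡ length q ℕ.+ sizeRev t
sizeRev-∷ʳ t q = trans (sym (length-prodRev (t ++ [ q ]))) (trans (cong length (prodRev-∷ʳ t q)) (trans (length-· q (prodRev t)) (cong (length q ℕ.+_) (length-prodRev t))))

st≢prodRev : ∀ r t → length r ≢ sizeRev t → ¬ (st r ≡ prodRev t)
st≢prodRev r t ne e = ne (trans (sym (length-st r)) (trans (cong length e) (length-prodRev t)))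

cutSum-short : ∀ X r t h → length r < sizeRev t → cutSum X r t h ≡ + 0
cutSum-short X r t [] lt = when-no (st≟prodRev r t) _ (st≢prodRev r t (ℕP.<⇒≢ lt))
cutSum-short X r t (q ∷ h) lt = trans (cong₂ _+ᶻ_ (when-no (st≟prodRev r t) _ (st≢prodRev r t (ℕP.<⇒≢ lt)))
   (cutSum-short X r (t ++ [ q ]) h (subst (length r <_) (sym (sizeRev-∷ʳ t q)) (ℕP.<-≤-trans lt (ℕP.m≤n+m _ (length q)))))) refl

+-split-≢₁ : ∀ {a b S Q T} → a ℕ.+ b ≡ (S ℕ.+ Q) ℕ.+ T → a ≤ S → 0 < Q → b ≢ T
+-split-≢₁ {a} {b} {S} {Q} {T} e le q refl = ℕP.<⇒≱ (subst (S <_) (sym (+-inj T e)) (ℕP.m<m+n S q)) le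

+-split-≡ : ∀ {a b S Q T} → a ℕ.+ b ≡ (S ℕ.+ Q) ℕ.+ T → a ≡ S ℕ.+ Q → b ≡ T
+-split-≡ {a} {b} {S} {Q} {T} e refl = ℕP.+-cancelˡ-≡ a b T e

+-split-< : ∀ {a b S Q T} → a ℕ.+ b ≡ (S ℕ.+ Q) ℕ.+ T → S < a → b < Q ℕ.+ T
+-split-< {a} {b} {S} {Q} {T} e lt = ℕP.+-cancelˡ-< S b (Q ℕ.+ T)
   (ℕP.<-≤-trans (ℕP.+-monoˡ-< b lt) (ℕP.≤-reflexive (trans e (ℕP.+-assoc S Q T))))

+-split-≢₂ : ∀ {a b S Q T} → a ℕ.+ b ≡ (S ℕ.+ Q) ℕ.+ T → a ≢ S ℕ.+ Q → b ≢ T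
+-split-≢₂ {a} {b} {S} {Q} {T} e ne refl = ne (+-inj b e)

-- A cut of prodRev h · prodRev t at position L is nonzero only at a factor boundary.
cutTerm≡cutSum : ∀ (X : List ℕ → ℤ) L r t h → All Irreducible h → L ℕ.+ length r ≡ sizeRev h ℕ.+ sizeRev t → L ≤ sizeRev h →
    cutTerm X L (st r) (prodRev h · prodRev t) ≡ cutSum X r t h
cutTerm≡cutSum X zero r t [] _ _ _ = when-iff (≡-dec _≟_ (map (ℕ._+ 0) (st r)) (map (ℕ._+ 0) (prodRev t))) (st≟prodRev r t) _ (λ e → LP.map-injective (+-inj 0) e) (cong (map (ℕ._+ 0)))
cutTerm≡cutSum X (suc L) r t [] _ _ ()
cutTerm≡cutSum X L r t (q ∷ h) (iq ∷ ih) sz le with L ≤? sizeRev h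
... | yes le' = begin
  cutTerm X L (st r) (prodRev (q ∷ h) · prodRev t)    ≡⟨ cong (cutTerm X L (st r)) reassoc ⟩
  cutTerm X L (st r) (prodRev h · prodRev (t ++ [ q ])) ≡⟨ cutTerm≡cutSum X L r (t ++ [ q ]) h ih sz' le' ⟩
  cutSum X r (t ++ [ q ]) h                             ≡⟨ sym (ℤP.+-identityˡ _) ⟩
  + 0 +ᶻ cutSum X r (t ++ [ q ]) h                      ≡⟨ cong (_+ᶻ cutSum X r (t ++ [ q ]) h) (sym (when-no (st≟prodRev r t) _
                                                            (st≢prodRev r t (+-split-≢₁ {S = sizeRev h} {Q = length q} sz le' (proj₁ iq))))) ⟩
  cutSum X r t (q ∷ h)                                  ∎
  where
  open ≡-Reasoning
  reassoc : prodRev (q ∷ h) · prodRev t ≡ prodRev h · prodRev (t ++ [ q ])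
  reassoc = trans (·-assoc (prodRev h) q (prodRev t)) (cong (prodRev h ·_) (sym (prodRev-∷ʳ t q)))
  sz' : L ℕ.+ length r ≡ sizeRev h ℕ.+ sizeRev (t ++ [ q ])
  sz' = trans sz (trans (ℕP.+-assoc (sizeRev h) (length q) (sizeRev t)) (cong (sizeRev h ℕ.+_) (sym (sizeRev-∷ʳ t q))))
... | no nle with L ≟ sizeRev (q ∷ h)
...   | yes eq = trans (at-boundary (trans eq (sym (length-prodRev (q ∷ h)))))
         (cong₂ _+ᶻ_ (when-iff (≡-dec _≟_ (map (ℕ._+ length A) (st r)) (map (ℕ._+ length A) (prodRev t))) (st≟prodRev r t) _
                       (LP.map-injective (+-inj _)) (cong (map (ℕ._+ _))))
           (sym (cutSum-short X r (t ++ [ q ]) h (subst (length r <_) (sym (sizeRev-∷ʳ t q))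
             (subst (_< length q ℕ.+ sizeRev t) (sym (+-split-≡ {S = sizeRev h} {Q = length q} sz eq)) (ℕP.m<n+m (sizeRev t) (proj₁ iq)))))))
  where
  A = prodRev (q ∷ h)
  at-boundary : L ≡ length A →
    cutTerm X L (st r) (A · prodRev t) ≡ when (≡-dec _≟_ (map (ℕ._+ length A) (st r)) (map (ℕ._+ length A) (prodRev t))) (- X A) +ᶻ + 0
  at-boundary refl rewrite drop-length-++ A (map (ℕ._+ length A) (prodRev t)) | take-length-++ A (map (ℕ._+ length A) (prodRev t)) = sym (ℤP.+-identityʳ _)
...   | no neq = begin
  cutTerm X L (st r) (prodRev (q ∷ h) · prodRev t)  ≡⟨ when-no (≡-dec _≟_ (map (ℕ._+ L) (st r)) (drop L (prodRev (q ∷ h) · prodRev t))) _ uncut ⟩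
  + 0                                               ≡⟨ sym (cong₂ _+ᶻ_ (when-no (st≟prodRev r t) _ (st≢prodRev r t (+-split-≢₂ {S = sizeRev h} {Q = length q} sz neq)))
                                                         (cutSum-short X r (t ++ [ q ]) h (subst (length r <_) (sym (sizeRev-∷ʳ t q)) (+-split-< {S = sizeRev h} {Q = length q} sz (ℕP.≰⇒> nle))))) ⟩
  cutSum X r t (q ∷ h)                              ∎
  where
  open ≡-Reasoning
  uncut : ¬ (map (ℕ._+ L) (st r) ≡ drop L (prodRev (q ∷ h) · prodRev t))
  uncut e = irreducible-uncut (prodRev h) q (prodRev t) r L iq
    (subst (_< L) (sym (length-prodRev h)) (ℕP.≰⇒> nle))
    (subst (L <_) (cong (ℕ._+ length q) (sym (length-prodRev h))) (ℕP.≤∧≢⇒< le neq))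
    (trans e (cong (drop L) (·-assoc (prodRev h) q (prodRev t))))

Increasing : (ℕ → ℕ) → List ℕ → Set
Increasing p = AllPairs (λ x y → p x < p y)

-- Counting chains, and the telescoping of the antipode recursion

-- For p = position α, the failure of Precedes is condition (iii).
Precedes : (ℕ → ℕ) → List ℕ → List ℕ → Set
Precedes p w s = All (λ x → All (λ y → p x < p y × x < y) s) w

precedesAll? : ∀ (p : ℕ → ℕ) (x : ℕ) (s : List ℕ) → Dec (All (λ y → p x < p y × x < y) s)
precedesAll? p x s = All.all? {P = λ y → p x < p y × x < y} (λ y → (p x <? p y) ×-dec (x <? y)) s

precedes? : ∀ (p : ℕ → ℕ) (w s : List ℕ) → Dec (Precedes p w s)
precedes? p w s = All.all? {P = λ x → All (λ y → p x < p y × x < y) s} (λ x → precedesAll? p x s) w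

PrecedesMaybe : (ℕ → ℕ) → List ℕ → Maybe (List ℕ) → Set
PrecedesMaybe p w nothing = ⊥
PrecedesMaybe p w (just s) = Precedes p w s

precedesMaybe? : ∀ (p : ℕ → ℕ) (w : List ℕ) (nb : Maybe (List ℕ)) → Dec (PrecedesMaybe p w nb)
precedesMaybe? p w nothing = no (λ ())
precedesMaybe? p w (just s) = precedes? p w s

st≟ : ∀ (w q : List ℕ) → Dec (st w ≡ q)
st≟ w q = ≡-dec _≟_ (st w) q

countEmpty : List ℕ → ℤ
countEmpty [] = + 1
countEmpty (_ ∷ _) = + 0

-- The number of ways to write α as a union of subwords B₁ ⋯ Bₘ with st Bᵢ the i-th word of
-- reverse qs and no Bᵢ preceding Bᵢ₊₁; the last block is split off first, and nb is the block
-- already split off to its right.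
chainCount : (ℕ → ℕ) → List ℕ → List (List ℕ) → Maybe (List ℕ) → ℤ
chainCount p α [] nb = countEmpty α
chainCount p α (q ∷ qs) nb = Σsplits α (λ l r → when (st≟ r q) (unless (precedesMaybe? p r nb) (chainCount p l qs (just r))))

unless-iff : ∀ {P Q : Set} (d : Dec P) (d' : Dec Q) a → (P → Q) → (Q → P) → unless d a ≡ unless d' a
unless-iff (yes p) (yes q) a f g = refl
unless-iff (yes p) (no ¬q) a f g = ⊥-elim (¬q (f p))
unless-iff (no ¬p) (yes q) a f g = ⊥-elim (¬p (g q))
unless-iff (no ¬p) (no ¬q) a f g = refl

when-cong : ∀ {P : Set} (d : Dec P) {a b} → (P → a ≡ b) → when d a ≡ when d b
when-cong (yes p) f = f p
when-cong (no _) f = refl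

when-split : ∀ {P Q : Set} (d : Dec P) (e : Dec Q) a → when d a ≡ when d (unless e a) +ᶻ when d (when e a)
when-split (yes _) (yes _) a = sym (ℤP.+-identityˡ a)
when-split (yes _) (no _) a = sym (ℤP.+-identityʳ a)
when-split (no _) e a = refl

when-+ : ∀ {P : Set} (d : Dec P) a b → when d (a +ᶻ b) ≡ when d a +ᶻ when d b
when-+ (yes _) a b = refl
when-+ (no _) a b = refl

when-Σsplits : ∀ {P : Set} (d : Dec P) w f → when d (Σsplits w f) ≡ Σsplits w (λ a b → when d (f a b))
when-Σsplits (yes _) w f = refl
when-Σsplits (no _) w f = sym (Σsplits-0 w)

when-neg-* : ∀ {P : Set} (d : Dec P) c a → when d (- (c * a)) ≡ - (c * when d a)
when-neg-* (yes _) c a = refl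
when-neg-* (no _) c a = sym (cong -_ (ℤP.*-zeroʳ c))

when-comm : ∀ {P Q : Set} (d : Dec P) (e : Dec Q) a → when d (when e a) ≡ when e (when d a)
when-comm (yes _) (yes _) a = refl
when-comm (yes _) (no _) a = refl
when-comm (no _) (yes _) a = refl
when-comm (no _) (no _) a = refl

when-× : ∀ {P Q R : Set} (d : Dec P) (e : Dec Q) (f : Dec R) a → (P → Q × R) → (Q → R → P) → when d a ≡ when e (when f a)
when-× (yes p) (yes q) (yes r) a g h = refl
when-× (yes p) (yes q) (no ¬r) a g h = ⊥-elim (¬r (proj₂ (g p)))
when-× (yes p) (no ¬q) f a g h = ⊥-elim (¬q (proj₁ (g p)))
when-× (no ¬p) (yes q) (yes r) a g h = ⊥-elim (¬p (h q r))
when-× (no ¬p) (yes q) (no _) a g h = refl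
when-× (no ¬p) (no _) f a g h = refl

when-yes : ∀ {P : Set} (d : Dec P) a → P → when d a ≡ a
when-yes (yes _) a _ = refl
when-yes (no ¬p) a p = ⊥-elim (¬p p)

Increasing-interleaving : ∀ {p l r w} → Interleaving l r w → Increasing p w → Increasing p l × Increasing p r
Increasing-interleaving [] _ = [] , []
Increasing-interleaving (consˡ i) (px ∷ pw) = (All.tabulate (λ m → All.lookup px (interleaving-∈ˡ i m)) ∷ proj₁ (Increasing-interleaving i pw)) , proj₂ (Increasing-interleaving i pw)
Increasing-interleaving (consʳ i) (px ∷ pw) = proj₁ (Increasing-interleaving i pw) , (All.tabulate (λ m → All.lookup px (interleaving-∈ʳ i m)) ∷ proj₂ (Increasing-interleaving i pw))

Increasing-++⁻ : ∀ {p} w r → Increasing p (w ++ r) → All (λ x → All (λ y → p x < p y) r) w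
Increasing-++⁻ [] r _ = []
Increasing-++⁻ (x ∷ w) r (px ∷ pw) = AllP.++⁻ʳ w px ∷ Increasing-++⁻ w r pw

Σprefixes : List ℕ → (List ℕ → List ℕ → ℤ) → ℤ
Σprefixes [] H = H [] []
Σprefixes (x ∷ xs) H = H [] (x ∷ xs) +ᶻ Σprefixes xs (λ w r → H (x ∷ w) r)

Σprefixes-cong : ∀ v {H H'} → (∀ w r → H w r ≡ H' w r) → Σprefixes v H ≡ Σprefixes v H'
Σprefixes-cong [] e = e [] []
Σprefixes-cong (x ∷ xs) e = cong₂ _+ᶻ_ (e [] (x ∷ xs)) (Σprefixes-cong xs (λ w r → e (x ∷ w) r))

Σprefixes-0 : ∀ v H → (∀ w r → H w r ≡ + 0) → Σprefixes v H ≡ + 0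
Σprefixes-0 [] H z = z [] []
Σprefixes-0 (x ∷ xs) H z = trans (cong₂ _+ᶻ_ (z [] (x ∷ xs)) (Σprefixes-0 xs _ (λ w r → z (x ∷ w) r))) refl

Σprefixes-single : ∀ v k H → (∀ w r → length w ≢ k → H w r ≡ + 0) → k ≤ length v → Σprefixes v H ≡ H (take k v) (drop k v)
Σprefixes-single [] zero H z _ = refl
Σprefixes-single (x ∷ xs) zero H z _ = trans (cong (H [] (x ∷ xs) +ᶻ_) (Σprefixes-0 xs _ (λ w r → z (x ∷ w) r (λ ())))) (ℤP.+-identityʳ _)
Σprefixes-single (x ∷ xs) (suc k) H z (s≤s le) = trans (cong₂ _+ᶻ_ (z [] (x ∷ xs) (λ ()))
   (Σprefixes-single xs k _ (λ w r ne → z (x ∷ w) r (λ e → ne (ℕP.suc-injective e))) le)) (ℤP.+-identityˡ _)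

Σprefixes-none : ∀ v k H → (∀ w r → length w ≢ k → H w r ≡ + 0) → length v < k → Σprefixes v H ≡ + 0
Σprefixes-none [] k H z lt = z [] [] (ℕP.<⇒≢ lt)
Σprefixes-none (x ∷ xs) (suc k) H z (s≤s lt) = trans (cong₂ _+ᶻ_ (z [] (x ∷ xs) (λ ()))
   (Σprefixes-none xs k _ (λ w r ne → z (x ∷ w) r (λ e → ne (ℕP.suc-injective e))) lt)) refl

Σsplits-all-right : ∀ v (E : List ℕ → List ℕ → ℤ) → (∀ {y w r} → Interleaving (y ∷ w) r v → E (y ∷ w) r ≡ + 0) → Σsplits v E ≡ E [] v
Σsplits-all-right [] E z = refl
Σsplits-all-right (y ∷ ys) E z = trans (Σsplits-cong ys (λ {l} {r} i → trans (cong (_+ᶻ E l (y ∷ r)) (z (consˡ i))) (ℤP.+-identityˡ _)))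
  (Σsplits-all-right ys (λ w r → E w (y ∷ r)) (λ i → z (consʳ i)))

-- In a p-increasing word only a prefix can precede its complement.
Σsplits-precedes≡Σprefixes : ∀ p v H → Increasing p v → Σsplits v (λ w r → when (precedes? p w r) (H w r)) ≡ Σprefixes v (λ w r → when (precedes? p w r) (H w r))
Σsplits-precedes≡Σprefixes p [] H _ = refl
Σsplits-precedes≡Σprefixes p (x ∷ xs) H (px ∷ pxs) =
  trans (Σsplits-+ xs (λ w r → when (precedes? p (x ∷ w) r) (H (x ∷ w) r)) (λ w r → when (precedes? p w (x ∷ r)) (H w (x ∷ r))))
  (trans (cong₂ _+ᶻ_ (trans (Σsplits-cong xs (λ {w} {r} _ → head-precedes w r)) (Σsplits-precedes≡Σprefixes p xs H-tail pxs)) x-on-right)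
  (trans (ℤP.+-comm (Σprefixes xs (λ w r → when (precedes? p w r) (H-tail w r))) (H [] (x ∷ xs)))
    (cong₂ _+ᶻ_ (sym (when-yes (precedes? p [] (x ∷ xs)) (H [] (x ∷ xs)) [])) (Σprefixes-cong xs (λ w r → sym (head-precedes w r))))))
  where
  H-tail : List ℕ → List ℕ → ℤ
  H-tail w r = when (precedesAll? p x r) (H (x ∷ w) r)
  head-precedes : ∀ w r → when (precedes? p (x ∷ w) r) (H (x ∷ w) r) ≡ when (precedes? p w r) (H-tail w r)
  head-precedes w r = when-× (precedes? p (x ∷ w) r) (precedes? p w r) (precedesAll? p x r) (H (x ∷ w) r) (λ { (a ∷ b) → b , a }) (λ b a → a ∷ b)
  x-on-right : Σsplits xs (λ w r → when (precedes? p w (x ∷ r)) (H w (x ∷ r))) ≡ H [] (x ∷ xs)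
  x-on-right = trans (Σsplits-all-right xs (λ w r → when (precedes? p w (x ∷ r)) (H w (x ∷ r))) (λ { {y} {w} {r} i → when-no (precedes? p (y ∷ w) (x ∷ r)) (H (y ∷ w) (x ∷ r)) (¬precedes i) }))
         (when-yes (precedes? p [] (x ∷ xs)) (H [] (x ∷ xs)) [])
    where
    ¬precedes : ∀ {y w r} → Interleaving (y ∷ w) r xs → ¬ Precedes p (y ∷ w) (x ∷ r)
    ¬precedes i ((q ∷ _) ∷ _) = ℕP.<-asym (proj₁ q) (All.lookup px (interleaving-∈ˡ i (here refl)))

when-0 : ∀ {P : Set} (d : Dec P) → when d (+ 0) ≡ + 0
when-0 (yes _) = refl
when-0 (no _) = refl

when³-no : ∀ {A B C : Set} (d1 : Dec A) (d2 : Dec B) (d3 : Dec C) g → ¬ (A × B × C) → when d1 (when d2 (when d3 g)) ≡ + 0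
when³-no (yes a) (yes b) (yes c) g f = ⊥-elim (f (a , b , c))
when³-no (yes a) (yes b) (no _) g f = refl
when³-no (yes a) (no _) d3 g f = refl
when³-no (no _) d2 d3 g f = refl

Increasing⇒Precedes : ∀ {p} w r → Increasing p (w ++ r) → AllBelow w r → Precedes p w r
Increasing⇒Precedes {p} w r inc lt = All.tabulate (λ {x} mx → All.tabulate (λ {y} my →
   All.lookup (All.lookup (Increasing-++⁻ w r inc) mx) my , All.lookup (All.lookup lt mx) my))

Precedes⇒AllBelow : ∀ {p w r} → Precedes p w r → AllBelow w r
Precedes⇒AllBelow m = All.map (All.map proj₂) m

Σsplits-lastBlock : ∀ p r' q t (G : List ℕ → ℤ) → Increasing p r' → Irreducible q → All Irreducible t →
    (∀ w r → Precedes p w r → 0 < length w → G w ≡ G (w ++ r)) →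
    Σsplits r' (λ w r → when (st≟prodRev r t) (when (st≟ w q) (when (precedes? p w r) (G w)))) ≡ when (st≟prodRev r' (t ++ [ q ])) (G r')
Σsplits-lastBlock p r' q t G inc iq it G-ext =
  trans (Σsplits-cong r' (λ {w} {r} _ → reorder w r)) (trans (Σsplits-precedes≡Σprefixes p r' H inc) single-prefix)
  where
  H : List ℕ → List ℕ → ℤ
  H w r = when (st≟prodRev r t) (when (st≟ w q) (G w))
  reorder : ∀ w r → when (st≟prodRev r t) (when (st≟ w q) (when (precedes? p w r) (G w))) ≡ when (precedes? p w r) (H w r)
  reorder w r = trans (cong (when (st≟prodRev r t)) (when-comm (st≟ w q) (precedes? p w r) (G w))) (when-comm (st≟prodRev r t) (precedes? p w r) _)
  wrong-length : ∀ w r → length w ≢ length q → when (precedes? p w r) (H w r) ≡ + 0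
  wrong-length w r ne = trans (when-cong (precedes? p w r) (λ _ → trans (when-cong (st≟prodRev r t)
      (λ _ → when-no (st≟ w q) (G w) (λ e → ne (trans (sym (length-st w)) (cong length e))))) (when-0 (st≟prodRev r t))))
    (when-0 (precedes? p w r))
  q≤ : All (λ x → x ≤ length q) q
  q≤ = All.map proj₂ (proj₁ (proj₂ iq))
  single-prefix : Σprefixes r' (λ w r → when (precedes? p w r) (H w r)) ≡ when (st≟prodRev r' (t ++ [ q ])) (G r')
  single-prefix with length q ≤? length r'
  ... | no nle = trans (Σprefixes-none r' (length q) _ wrong-length (ℕP.≰⇒> nle))
        (sym (when-no (st≟prodRev r' (t ++ [ q ])) (G r') (st≢prodRev r' (t ++ [ q ]) (λ e → nle (subst (length q ≤_) (sym e) (subst (length q ≤_) (sym (sizeRev-∷ʳ t q)) (ℕP.m≤m+n _ _)))))))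
  ... | yes le = trans (Σprefixes-single r' (length q) _ wrong-length le) at-split
    where
    w₀ = take (length q) r'
    r₀ = drop (length q) r'
    |w₀| : length w₀ ≡ length q
    |w₀| = trans (LP.length-take (length q) r') (ℕP.m≤n⇒m⊓n≡m le)
    w₀++r₀ : w₀ ++ r₀ ≡ r'
    w₀++r₀ = LP.take++drop≡id (length q) r'
    at-split : when (precedes? p w₀ r₀) (when (st≟prodRev r₀ t) (when (st≟ w₀ q) (G w₀))) ≡ when (st≟prodRev r' (t ++ [ q ])) (G r')
    at-split with st≟prodRev r' (t ++ [ q ])
    ... | yes st-r' = trans (when-yes (precedes? p w₀ r₀) _ (Increasing⇒Precedes w₀ r₀ (subst (Increasing p) (sym w₀++r₀) inc) (proj₁ split)))
                  (trans (when-yes (st≟prodRev r₀ t) _ (proj₂ (proj₂ split))) (trans (when-yes (st≟ w₀ q) _ (proj₁ (proj₂ split)))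
                    (trans (G-ext w₀ r₀ (Increasing⇒Precedes w₀ r₀ (subst (Increasing p) (sym w₀++r₀) inc) (proj₁ split)) (subst (0 <_) (sym |w₀|) (proj₁ iq))) (cong G w₀++r₀))))
      where
      split = st-++⁻ w₀ r₀ q (prodRev t) |w₀| q≤ (prodRev-positive t it) (trans (cong st w₀++r₀) (trans st-r' (prodRev-∷ʳ t q)))
    ... | no ¬st-r' = when³-no (precedes? p w₀ r₀) (st≟prodRev r₀ t) (st≟ w₀ q) (G w₀)
          (λ { (m , st-r₀ , st-w₀) → ¬st-r' (trans (cong st (sym w₀++r₀)) (trans (st-++ w₀ r₀ (Precedes⇒AllBelow m)) (trans (cong₂ _·_ st-w₀ st-r₀) (sym (prodRev-∷ʳ t q))))) })

Precedes-++⁺ : ∀ {p u w r} → Precedes p w r → 0 < length w → Precedes p u w → Precedes p u (w ++ r)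
Precedes-++⁺ {p} {u} {w₀ ∷ w} {r} (w₀<r ∷ _) _ u<w = All.map (λ x<w → AllP.++⁺ x<w
  (All.map (λ w₀<y → ℕP.<-trans (proj₁ (All.lookup x<w (here refl))) (proj₁ w₀<y) , ℕP.<-trans (proj₂ (All.lookup x<w (here refl))) (proj₂ w₀<y)) w₀<r)) u<w

Precedes-++⁻ : ∀ {p u w r} → Precedes p u (w ++ r) → Precedes p u w
Precedes-++⁻ {w = w} m = All.map (AllP.++⁻ˡ w) m

chainCount-cong : ∀ p l h s s' → (∀ u → Precedes p u s → Precedes p u s') → (∀ u → Precedes p u s' → Precedes p u s) → chainCount p l h (just s) ≡ chainCount p l h (just s')
chainCount-cong p l [] s s' to from = refl
chainCount-cong p l (q ∷ h) s s' to from = Σsplits-cong l (λ {a} {b} _ → when-cong (st≟ b q) (λ _ → unless-iff (precedes? p b s) (precedes? p b s') _ (to b) (from b)))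

openSum : (ℕ → ℕ) → List ℕ → List (List ℕ) → List (List ℕ) → ℤ
openSum p α t h = Σsplits α (λ l r → when (st≟prodRev r t) (chainCount p l h nothing))

closedSum : (ℕ → ℕ) → List ℕ → List (List ℕ) → List (List ℕ) → ℤ
closedSum p α t h = Σsplits α (λ l r → when (st≟prodRev r t) (chainCount p l h (just r)))

openSum≡closedSum+closedSum : ∀ p α t q h → Increasing p α → Irreducible q → All Irreducible t → openSum p α t (q ∷ h) ≡ closedSum p α t (q ∷ h) +ᶻ closedSum p α (t ++ [ q ]) h
openSum≡closedSum+closedSum p α t q h inc iq it =
  trans (Σsplits-cong α (λ {l} {r} _ → trans (when-cong (st≟prodRev r t) (λ _ → split-last l r)) (when-+ (st≟prodRev r t) _ _)))
  (trans (Σsplits-+ α _ _) (cong (closedSum p α t (q ∷ h) +ᶻ_)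
   (trans (Σsplits-cong α (λ {l} {r} _ → when-Σsplits (st≟prodRev r t) l _))
   (trans (Σsplits-coassoc α summand)
   (Σsplits-cong α (λ {l'} {r'} i → Σsplits-lastBlock p r' q t (λ w → chainCount p l' h (just w)) (proj₂ (Increasing-interleaving i inc)) iq it
      (λ w r m lw → chainCount-cong p l' h w (w ++ r) (λ u → Precedes-++⁺ m lw) (λ u → Precedes-++⁻)) ))))))
  where
  innerSum : List ℕ → List ℕ → ℤ
  innerSum l r = Σsplits l (λ l' w → when (st≟ w q) (when (precedes? p w r) (chainCount p l' h (just w))))
  split-last : ∀ l r → chainCount p l (q ∷ h) nothing ≡ chainCount p l (q ∷ h) (just r) +ᶻ innerSum l r
  split-last l r = trans (Σsplits-cong l (λ {l'} {w} _ → when-split (st≟ w q) (precedes? p w r) (chainCount p l' h (just w)))) (Σsplits-+ l _ _)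
  summand : List ℕ → List ℕ → List ℕ → ℤ
  summand l' w r = when (st≟prodRev r t) (when (st≟ w q) (when (precedes? p w r) (chainCount p l' h (just w))))

alternatingSum : (ℕ → ℕ) → List ℕ → List (List ℕ) → List (List ℕ) → ℤ
alternatingSum p α t [] = openSum p α t []
alternatingSum p α t (q ∷ h) = sgn (length (q ∷ h)) * openSum p α t (q ∷ h) +ᶻ alternatingSum p α (t ++ [ q ]) h

telescope-step : ∀ s b1 b2 x → x ≡ s * b2 → (- s) * (b1 +ᶻ b2) +ᶻ x ≡ (- s) * b1
telescope-step s b1 b2 x refl = trans (cong (_+ᶻ s * b2) (ℤP.*-distribˡ-+ (- s) b1 b2))
  (trans (ℤP.+-assoc ((- s) * b1) ((- s) * b2) (s * b2))
  (trans (cong ((- s) * b1 +ᶻ_) (trans (cong (_+ᶻ s * b2) (sym (ℤP.neg-distribˡ-* s b2))) (ℤP.+-inverseˡ (s * b2)))) (ℤP.+-identityʳ _)))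

alternatingSum≡closedSum : ∀ p α t h → Increasing p α → All Irreducible t → All Irreducible h → alternatingSum p α t h ≡ sgn (length h) * closedSum p α t h
alternatingSum≡closedSum p α t [] inc it ih = sym (ℤP.*-identityˡ _)
alternatingSum≡closedSum p α t (q ∷ h) inc it (iq ∷ ih) = trans (cong (λ z → sgn (length (q ∷ h)) * z +ᶻ alternatingSum p α (t ++ [ q ]) h) (openSum≡closedSum+closedSum p α t q h inc iq it))
  (telescope-step (sgn (length h)) _ _ _ (alternatingSum≡closedSum p α (t ++ [ q ]) h inc (AllP.++⁺ it (iq ∷ [])) ih))

chainCutSum : (ℕ → ℕ) → List ℕ → List ℕ → List (List ℕ) → List (List ℕ) → ℤ
chainCutSum p l r t [] = when (st≟prodRev r t) (- chainCount p l [] nothing)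
chainCutSum p l r t (q ∷ h) = when (st≟prodRev r t) (- (sgn (length (q ∷ h)) * chainCount p l (q ∷ h) nothing)) +ᶻ chainCutSum p l r (t ++ [ q ]) h

chainCutSum-short : ∀ p l r t h → length r < sizeRev t → chainCutSum p l r t h ≡ + 0
chainCutSum-short p l r t [] lt = when-no (st≟prodRev r t) _ (st≢prodRev r t (ℕP.<⇒≢ lt))
chainCutSum-short p l r t (q ∷ h) lt = trans (cong₂ _+ᶻ_ (when-no (st≟prodRev r t) _ (st≢prodRev r t (ℕP.<⇒≢ lt)))
   (chainCutSum-short p l r (t ++ [ q ]) h (subst (length r <_) (sym (sizeRev-∷ʳ t q)) (ℕP.<-≤-trans lt (ℕP.m≤n+m _ (length q)))))) refl

when-neg : ∀ {P : Set} (d : Dec P) a → when d (- a) ≡ - when d a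
when-neg (yes _) a = refl
when-neg (no _) a = refl

Σsplits-chainCutSum : ∀ p α t h → Σsplits α (λ l r → chainCutSum p l r t h) ≡ - alternatingSum p α t h
Σsplits-chainCutSum p α t [] = trans (Σsplits-cong α (λ {l} {r} _ → when-neg (st≟prodRev r t) _)) (Σsplits-neg α _)
Σsplits-chainCutSum p α t (q ∷ h) = trans (Σsplits-+ α _ _) (trans (cong₂ _+ᶻ_
   (trans (Σsplits-cong α (λ {l} {r} _ → when-neg-* (st≟prodRev r t) (sgn (length (q ∷ h))) _))
     (trans (Σsplits-neg α _) (cong -_ (Σsplits-* α (sgn (length (q ∷ h))) (λ l r → when (st≟prodRev r t) (chainCount p l (q ∷ h) nothing))))))
   (Σsplits-chainCutSum p α (t ++ [ q ]) h)) (sym (ℤP.neg-distrib-+ (sgn (length (q ∷ h)) * openSum p α t (q ∷ h)) (alternatingSum p α (t ++ [ q ]) h))))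

cutSum≡chainCutSum : ∀ (X : List ℕ → ℤ) p l r t h → All Irreducible h → length l ℕ.+ length r ≡ sizeRev h ℕ.+ sizeRev t →
  (∀ h' → All Irreducible h' → length l ≡ sizeRev h' → X (prodRev h') ≡ sgn (length h') * chainCount p l h' nothing) →
  cutSum X r t h ≡ chainCutSum p l r t h
cutSum≡chainCutSum X p l r t [] _ sz ih = when-cong (st≟prodRev r t) (λ e → cong -_ (trans (ih [] [] (ll e)) (ℤP.*-identityˡ _)))
  where
  ll : st r ≡ prodRev t → length l ≡ 0
  ll e = +-inj (length r) (trans sz (sym (trans (sym (length-st r)) (trans (cong length e) (length-prodRev t)))))
cutSum≡chainCutSum X p l r t (q ∷ h) (iq ∷ ih') sz ih = cong₂ _+ᶻ_ (when-cong (st≟prodRev r t) (λ e → cong -_ (ih (q ∷ h) (iq ∷ ih') (ll e))))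
   (cutSum≡chainCutSum X p l r (t ++ [ q ]) h ih' sz' ih)
  where
  ll : st r ≡ prodRev t → length l ≡ sizeRev (q ∷ h)
  ll e = +-inj (length r) (trans sz (cong (sizeRev (q ∷ h) ℕ.+_) (sym (trans (sym (length-st r)) (trans (cong length e) (length-prodRev t))))))
  sz' : length l ℕ.+ length r ≡ sizeRev h ℕ.+ sizeRev (t ++ [ q ])
  sz' = trans sz (trans (ℕP.+-assoc (sizeRev h) (length q) (sizeRev t)) (cong (sizeRev h ℕ.+_) (sym (sizeRev-∷ʳ t q))))

coeff-antipodeTerm : ∀ k p l r q qs → 0 < length r → All Irreducible (q ∷ qs) → length l ℕ.+ length r ≡ sizeRev qs ℕ.+ length q →
  (∀ h → All Irreducible h → length l ≡ sizeRev h → coeff (antipodeF k l) (prodRev h) ≡ sgn (length h) * chainCount p l h nothing) →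
  coeff (antipodeTerm k l r) (prodRev (q ∷ qs)) ≡ chainCutSum p l r [ q ] qs
coeff-antipodeTerm k p l r@(_ ∷ _) q qs _ iqs sz IH = begin
  coeff (negMul (st r) (antipodeF k (st l))) γ                         ≡⟨ coeff-negMul (st r) (antipodeF k (st l)) (length (st l)) γ (antipodeF-lengths k (st l)) ⟩
  cutTerm (coeff (antipodeF k (st l))) (length (st l)) (st r) γ         ≡⟨ cong₂ (λ S L → cutTerm (coeff S) L (st r) γ) (antipodeF-st k l) (length-st l) ⟩
  cutTerm X (length l) (st r) γ                                         ≡⟨ cong (cutTerm X (length l) (st r)) (sym (·[] γ)) ⟩
  cutTerm X (length l) (st r) (prodRev (q ∷ qs) · prodRev [])           ≡⟨ cutTerm≡cutSum X (length l) r [] (q ∷ qs) iqs sz′ l≤ ⟩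
  cutSum X r [] (q ∷ qs)                                                ≡⟨ cong (_+ᶻ cutSum X r [ q ] qs) (when-no (st≟prodRev r []) (- X γ) (st≢prodRev r [] λ ())) ⟩
  + 0 +ᶻ cutSum X r [ q ] qs                                            ≡⟨ ℤP.+-identityˡ _ ⟩
  cutSum X r [ q ] qs                                                   ≡⟨ cutSum≡chainCutSum X p l r [ q ] qs (All.tail iqs) sz IH ⟩
  chainCutSum p l r [ q ] qs                                            ∎
  where
  open ≡-Reasoning
  γ = prodRev (q ∷ qs)
  X : List ℕ → ℤ
  X = coeff (antipodeF k l)
  sz′ : length l ℕ.+ length r ≡ sizeRev (q ∷ qs) ℕ.+ 0
  sz′ = trans sz (sym (ℕP.+-identityʳ _))
  l≤ : length l ≤ sizeRev (q ∷ qs)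
  l≤ = subst (length l ≤_) sz (ℕP.m≤m+n (length l) (length r))

coeff-antipodeF-prodRev : ∀ k α p qs → length α ≤ k → Increasing p α → All Irreducible qs → length α ≡ sizeRev qs →
   coeff (antipodeF k α) (prodRev qs) ≡ sgn (length qs) * chainCount p α qs nothing
coeff-antipodeF-prodRev k [] p [] _ _ _ _ = refl
coeff-antipodeF-prodRev k [] p (q ∷ qs) _ _ (iq ∷ _) e = ⊥-elim (ℕP.<⇒≢ (ℕP.<-≤-trans (proj₁ iq) (ℕP.m≤n+m (length q) (sizeRev qs))) e)
coeff-antipodeF-prodRev zero (x ∷ xs) p qs () _ _ _
coeff-antipodeF-prodRev (suc k) (x ∷ xs) p [] _ _ _ ()
coeff-antipodeF-prodRev (suc k) α@(x ∷ xs) p (q ∷ qs) (s≤s le) inc iqs@(iq ∷ iqs′) sz = begin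
  coeff (antipodeF (suc k) α) γ                           ≡⟨ cong (λ S → coeff S γ) (antipodeF-suc k x xs) ⟩
  coeff (concatSplits α (antipodeTerm k)) γ               ≡⟨ coeff-concatSplits α (antipodeTerm k) γ ⟩
  Σsplits α (λ l r → coeff (antipodeTerm k l r) γ)        ≡⟨ Σsplits-cong α term≡ ⟩
  Σsplits α (λ l r → chainCutSum p l r [ q ] qs)          ≡⟨ Σsplits-chainCutSum p α [ q ] qs ⟩
  - alternatingSum p α [ q ] qs                           ≡⟨ cong -_ (alternatingSum≡closedSum p α [ q ] qs inc (iq ∷ []) iqs′) ⟩
  - (sgn (length qs) * closedSum p α [ q ] qs)           ≡⟨ ℤP.neg-distribˡ-* (sgn (length qs)) _ ⟩
  sgn (length (q ∷ qs)) * closedSum p α [ q ] qs          ≡⟨ cong (sgn (length (q ∷ qs)) *_) (sym chainCount≡closedSum) ⟩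
  sgn (length (q ∷ qs)) * chainCount p α (q ∷ qs) nothing ∎
  where
  open ≡-Reasoning
  γ = prodRev (q ∷ qs)
  chainCount≡closedSum : chainCount p α (q ∷ qs) nothing ≡ closedSum p α [ q ] qs
  chainCount≡closedSum = Σsplits-cong α (λ {l} {r} _ →
    when-iff (st≟ r q) (st≟prodRev r [ q ]) (chainCount p l qs (just r)) (λ e → trans e (sym ([]· q))) (λ e → trans e ([]· q)))
  term≡ : ∀ {l r} → Interleaving l r α → coeff (antipodeTerm k l r) γ ≡ chainCutSum p l r [ q ] qs
  term≡ {l} {[]} _ = sym (chainCutSum-short p l [] [ q ] qs (proj₁ iq))
  term≡ {l} {r@(_ ∷ _)} i = coeff-antipodeTerm k p l r q qs (s≤s z≤n) iqs (trans (sym (interleave-length i)) sz)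
    (λ h ih e → coeff-antipodeF-prodRev k l p h l≤k (proj₁ (Increasing-interleaving i inc)) ih e)
    where
    l≤k : length l ≤ k
    l≤k = ℕP.≤-pred (ℕP.≤-trans (subst (length l <_) (sym (interleave-length i)) (ℕP.m<m+n (length l) (s≤s z≤n))) (s≤s le))

-- Words as permutations of [n]

same-elements⇒↭ : ∀ {xs ys : List ℕ} → Unique xs → Unique ys → (∀ {x} → x ∈ xs → x ∈ ys) → (∀ {x} → x ∈ ys → x ∈ xs) → xs ↭ ys
same-elements⇒↭ u u' f g = ∼bag⇒↭ (unique∧set⇒bag u u' (mk⇔ f g))

∈-remove : ∀ {z x : ℕ} a b → z ∈ a ++ x ∷ b → z ≢ x → z ∈ a ++ b
∈-remove [] b (here refl) ne = ⊥-elim (ne refl)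
∈-remove [] b (there m) ne = m
∈-remove (y ∷ a) b (here p) ne = here p
∈-remove (y ∷ a) b (there m) ne = there (∈-remove a b m ne)

length-++-∷ : ∀ (a : List ℕ) x b → length (a ++ x ∷ b) ≡ suc (length (a ++ b))
length-++-∷ [] x b = refl
length-++-∷ (y ∷ a) x b = cong suc (length-++-∷ a x b)

length-mono-⊆ : ∀ {xs ys : List ℕ} → Unique ys → (∀ {x} → x ∈ ys → x ∈ xs) → length ys ≤ length xs
length-mono-⊆ {xs} {[]} u sub = z≤n
length-mono-⊆ {xs} {y ∷ ys} (uy ∷ u) sub with ∈-∃++ (sub (here refl))
... | a , b , refl = subst (suc (length ys) ≤_) (sym (length-++-∷ a y b))
   (s≤s (length-mono-⊆ u (λ {z} m → ∈-remove a b (sub (there m)) (λ e → All.lookup uy m (sym e)))))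

length-≤⇒⊇ : ∀ {xs ys : List ℕ} → Unique ys → (∀ {x} → x ∈ ys → x ∈ xs) → length xs ≤ length ys → ∀ {z} → z ∈ xs → z ∈ ys
length-≤⇒⊇ {xs} {ys} u sub le {z} m with Any.any? (z ≟_) ys
... | yes z∈ys = z∈ys
... | no ¬a = ⊥-elim (ℕP.<⇒≱ (length-mono-⊆ {xs} {z ∷ ys} (All.tabulate (λ m' e → ¬a (subst (_∈ ys) (sym e) m')) ∷ u)
      (λ { (here refl) → m ; (there m') → sub m' })) le)

∈-range⁻ : ∀ {n x} → x ∈ range n → 1 ≤ x × x ≤ n
∈-range⁻ {n} m with ∈-map⁻ suc m
... | i , mi , refl = s≤s z≤n , ∈-upTo⁻ mi

∈-range⁺ : ∀ {n x} → 1 ≤ x → x ≤ n → x ∈ range n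
∈-range⁺ {n} {suc x} _ le = ∈-map⁺ suc (∈-upTo⁺ le)

range-unique : ∀ n → Unique (range n)
range-unique n = UP.map⁺ ℕP.suc-injective (UP.upTo⁺ n)

length-range : ∀ n → length (range n) ≡ n
length-range n = trans (LP.length-map suc (upTo n)) (LP.length-applyUpTo (λ x → x) n)

Unique-resp-↭ : ∀ {xs ys : List ℕ} → xs ↭ ys → Unique xs → Unique ys
Unique-resp-↭ _↭_.refl u = u
Unique-resp-↭ (_↭_.prep x p) (ux ∷ u) = PP.All-resp-↭ p ux ∷ Unique-resp-↭ p u
Unique-resp-↭ (_↭_.swap x y p) ((x≢y ∷ ux) ∷ uy ∷ u) = ((λ e → x≢y (sym e)) ∷ PP.All-resp-↭ p uy) ∷ PP.All-resp-↭ p ux ∷ Unique-resp-↭ p u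
Unique-resp-↭ (_↭_.trans p q) u = Unique-resp-↭ q (Unique-resp-↭ p u)

word-unique : ∀ {n β} → β ↭ range n → Unique β
word-unique {n} p = Unique-resp-↭ (↭-sym p) (range-unique n)

Unique-map⁺ : ∀ {A B : Set} {xs : List A} (f : A → B) → Unique xs → (∀ {a b} → a ∈ xs → b ∈ xs → f a ≡ f b → a ≡ b) → Unique (map f xs)
Unique-map⁺ {xs = []} f u inj = []
Unique-map⁺ {xs = x ∷ xs} f (ux ∷ u) inj = AllP.map⁺ (All.tabulate (λ {y} m e → All.lookup ux m (inj (here refl) (there m) e))) ∷ Unique-map⁺ f u (λ ma mb → inj (there ma) (there mb))

countLt-≤ : ∀ x (w : List ℕ) → countLt x w ≤ length w
countLt-≤ x [] = z≤n
countLt-≤ x (y ∷ ys) with y <? x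
... | yes _ = s≤s (countLt-≤ x ys)
... | no _ = ℕP.m≤n⇒m≤1+n (countLt-≤ x ys)

countLt-< : ∀ {x} (w : List ℕ) → x ∈ w → countLt x w < length w
countLt-< {x} (y ∷ ys) m with y <? x
countLt-< {x} (y ∷ ys) (here refl) | yes p = ⊥-elim (ℕP.<-irrefl refl p)
countLt-< {x} (y ∷ ys) (there m) | yes p = s≤s (countLt-< ys m)
countLt-< {x} (y ∷ ys) m | no _ = s≤s (countLt-≤ x ys)

st-↭-range : ∀ {r : List ℕ} → Unique r → st r ↭ range (length r)
st-↭-range {r} u = same-elements⇒↭ unique (range-unique (length r)) ⊆range
   (length-≤⇒⊇ unique ⊆range (ℕP.≤-reflexive (trans (length-range (length r)) (sym (length-st r)))))
  where
  rank-injective : ∀ {a b} → a ∈ r → b ∈ r → rank r a ≡ rank r b → a ≡ b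
  rank-injective {a} {b} ma mb e with ℕP.<-cmp a b
  ... | tri< lt _ _ = ⊥-elim (ℕP.<⇒≢ (rank-mono-< r ma lt) e)
  ... | tri≈ _ eq _ = eq
  ... | tri> _ _ gt = ⊥-elim (ℕP.<⇒≢ (rank-mono-< r mb gt) (sym e))
  unique : Unique (st r)
  unique = Unique-map⁺ (rank r) u rank-injective
  ⊆range : ∀ {x} → x ∈ st r → x ∈ range (length r)
  ⊆range m with ∈-map⁻ (rank r) m
  ... | y , my , refl = ∈-range⁺ (s≤s z≤n) (subst (_≤ length r) (sym (rank≡suc-countLt r y)) (countLt-< r my))

range-++-shift : ∀ a b → range a ++ map (ℕ._+ a) (range b) ↭ range (a ℕ.+ b)
range-++-shift a b = same-elements⇒↭ (UP.++⁺ (range-unique a) (UP.map⁺ (λ {x} {y} e → +a-injective e) (range-unique b)) disjoint) (range-unique (a ℕ.+ b)) ⊆range range⊆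
  where
  +a-injective : ∀ {x y} → x ℕ.+ a ≡ y ℕ.+ a → x ≡ y
  +a-injective {x} {y} e = ℕP.+-cancelʳ-≡ a x y e
  disjoint : ∀ {v} → ¬ (v ∈ range a × v ∈ map (ℕ._+ a) (range b))
  disjoint (m1 , m2) with ∈-map⁻ (ℕ._+ a) m2
  ... | u , mu , refl = ℕP.<⇒≱ (ℕP.+-monoˡ-≤ a (proj₁ (∈-range⁻ mu))) (proj₂ (∈-range⁻ m1))
  ⊆range : ∀ {x} → x ∈ range a ++ map (ℕ._+ a) (range b) → x ∈ range (a ℕ.+ b)
  ⊆range {x} m with ∈-++⁻ (range a) m
  ... | inj₁ m1 = ∈-range⁺ (proj₁ (∈-range⁻ m1)) (ℕP.≤-trans (proj₂ (∈-range⁻ m1)) (ℕP.m≤m+n a b))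
  ... | inj₂ m2 with ∈-map⁻ (ℕ._+ a) m2
  ...   | u , mu , refl = ∈-range⁺ (ℕP.≤-trans (proj₁ (∈-range⁻ mu)) (ℕP.m≤m+n u a)) (subst (u ℕ.+ a ≤_) (ℕP.+-comm b a) (ℕP.+-monoˡ-≤ a (proj₂ (∈-range⁻ mu))))
  range⊆ : ∀ {x} → x ∈ range (a ℕ.+ b) → x ∈ range a ++ map (ℕ._+ a) (range b)
  range⊆ {x} m with x ≤? a
  ... | yes le = ∈-++⁺ˡ (∈-range⁺ (proj₁ (∈-range⁻ m)) le)
  ... | no nle = ∈-++⁺ʳ (range a) (subst (_∈ map (ℕ._+ a) (range b)) (ℕP.m∸n+n≡m (ℕP.<⇒≤ (ℕP.≰⇒> nle)))
        (∈-map⁺ (ℕ._+ a) (∈-range⁺ (ℕP.m<n⇒0<n∸m (ℕP.≰⇒> nle)) (ℕP.m≤n+o⇒m∸n≤o x a (proj₂ (∈-range⁻ m))))))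

·-↭-range : ∀ {u s a b} → u ↭ range a → s ↭ range b → u · s ↭ range (a ℕ.+ b)
·-↭-range {u} {s} {a} {b} pu ps = ↭-trans (PP.++⁺ pu (PP.map⁺ (ℕ._+ length u) ps))
  (subst (λ z → range a ++ map (ℕ._+ z) (range b) ↭ range (a ℕ.+ b)) (sym (trans (PP.↭-length pu) (length-range a))) (range-++-shift a b))

Unique-interleaving : ∀ {l r w} → Interleaving l r w → Unique w → Unique l × Unique r
Unique-interleaving [] _ = [] , []
Unique-interleaving (consˡ i) (ux ∷ uw) = (All.tabulate (λ m → All.lookup ux (interleaving-∈ˡ i m)) ∷ proj₁ (Unique-interleaving i uw)) , proj₂ (Unique-interleaving i uw)
Unique-interleaving (consʳ i) (ux ∷ uw) = proj₁ (Unique-interleaving i uw) , (All.tabulate (λ m → All.lookup ux (interleaving-∈ʳ i m)) ∷ proj₂ (Unique-interleaving i uw))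

antipodeF-support : ∀ k w → Unique w → All (λ e → proj₂ e ↭ range (length w)) (antipodeF k w)
antipodeF-support _ [] _ = ↭-refl ∷ []
antipodeF-support zero (_ ∷ _) _ = []
antipodeF-support (suc k) (x ∷ xs) u =
  subst (All _) (sym (antipodeF-suc k x xs)) (All-concatSplits (x ∷ xs) _ term-support)
  where
  term-support : ∀ {l r} → Interleaving l r (x ∷ xs) → All (λ e → proj₂ e ↭ range (length (x ∷ xs))) (antipodeTerm k l r)
  term-support {l} {[]} _ = []
  term-support {l} {r@(_ ∷ _)} i =
    subst (λ m → All (λ e → proj₂ e ↭ range m) (antipodeTerm k l r))
      (trans (cong (ℕ._+ length r) (length-st l)) (sym (interleave-length i)))
      (AllP.map⁺ (All.map (λ u↭ → ·-↭-range u↭ (st-↭-range ur))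
        (antipodeF-support k (st l) (Unique-resp-↭ (↭-sym (st-↭-range ul)) (range-unique (length l))))))
    where
    ul = proj₁ (Unique-interleaving i u)
    ur = proj₂ (Unique-interleaving i u)

coeff-outside-support : ∀ (X : Elt) n u → All (λ e → proj₂ e ↭ range n) X → ¬ (u ↭ range n) → coeff X u ≡ + 0
coeff-outside-support [] n u _ _ = refl
coeff-outside-support ((c , v) ∷ X) n u (p ∷ ps) nu with ≡-dec _≟_ v u
... | yes refl = ⊥-elim (nu p)
... | no _ = coeff-outside-support X n u ps nu

coeff-antipode-nonword : ∀ n α → IsWord n α → ∀ u → ¬ IsWord n u → coeff (antipode α) u ≡ + 0
coeff-antipode-nonword n α w u nu = coeff-outside-support (antipode α) n u
  (subst (λ z → All (λ e → proj₂ e ↭ range z) (antipode α)) (trans (PP.↭-length w) (length-range n)) (antipodeF-support (length α) α (word-unique w))) nu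

-- The join of β and β ∘ γ

size : List (List ℕ) → ℕ
size [] = 0
size (π ∷ ps) = length π ℕ.+ size ps

prod : List (List ℕ) → List ℕ
prod [] = []
prod (π ∷ ps) = π · prod ps

length-prod : ∀ ps → length (prod ps) ≡ size ps
length-prod [] = refl
length-prod (π ∷ ps) = trans (length-· π (prod ps)) (cong (length π ℕ.+_) (length-prod ps))

blocks : List ℕ → List (List ℕ) → SetComp
blocks β [] = []
blocks β (π ∷ ps) = take (length π) β ∷ blocks (drop (length π) β) ps

at-take : ∀ β k j → j ≤ k → at β j ≡ at (take k β) j
at-take [] zero j le = refl
at-take [] (suc k) j le = refl
at-take (x ∷ xs) zero zero le = refl
at-take (x ∷ xs) (suc k) zero le = refl
at-take (x ∷ xs) (suc k) (suc zero) le = refl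
at-take (x ∷ xs) (suc k) (suc (suc j)) (s≤s le) = at-take xs k (suc j) le

at-drop : ∀ β k j → at β (suc j ℕ.+ k) ≡ at (drop k β) (suc j)
at-drop β zero j = cong (λ z → at β (suc z)) (ℕP.+-identityʳ j)
at-drop [] (suc k) j = refl
at-drop (x ∷ xs) (suc k) j rewrite ℕP.+-suc j k = at-drop xs k j

compose-split : ∀ β π γ' → All (λ x → 1 ≤ x × x ≤ length π) π → All (1 ≤_) γ' →
  compose β (π · γ') ≡ compose (take (length π) β) π ++ compose (drop (length π) β) γ'
compose-split β π γ' pπ pγ = trans (LP.map-++ (at β) π _) (cong₂ _++_
  (LP.map-cong-local (All.map (λ {x} p → at-take β (length π) x (proj₂ p)) pπ))
  (trans (sym (LP.map-∘ γ')) (LP.map-cong-local (All.map (λ { {suc j} _ → at-drop β (length π) j }) pγ))))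

applyUpTo-map : ∀ (f : ℕ → ℕ) n → applyUpTo f n ≡ map f (upTo n)
applyUpTo-map f zero = refl
applyUpTo-map f (suc n) = cong (f 0 ∷_) (trans (applyUpTo-map (f ∘ suc) n) (trans (LP.map-∘ (upTo n)) (cong (map f) (sym (applyUpTo-map suc n)))))

range-suc : ∀ c → range (suc c) ≡ 1 ∷ map suc (range c)
range-suc c = cong (λ z → 1 ∷ map suc z) (applyUpTo-map suc c)

map-at-range : ∀ b c → c ≤ length b → map (at b) (range c) ≡ take c b
map-at-range b zero le = refl
map-at-range (x ∷ xs) (suc c) (s≤s le) = trans (cong (map (at (x ∷ xs))) (range-suc c)) (cong (x ∷_)
  (trans (sym (LP.map-∘ (range c))) (trans (LP.map-cong-local (All.tabulate (λ {j} m → at-suc j (proj₁ (∈-range⁻ m))))) (map-at-range xs c le))))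
  where
  at-suc : ∀ j → 1 ≤ j → at (x ∷ xs) (suc j) ≡ at xs j
  at-suc (suc j) _ = refl

take-length : ∀ (b : List ℕ) → take (length b) b ≡ b
take-length [] = refl
take-length (x ∷ b) = cong (x ∷_) (take-length b)

compose-perm : ∀ b π → length π ≡ length b → π ↭ range (length π) → compose b π ↭ b
compose-perm b π e p = subst (compose b π ↭_) (trans (map-at-range b (length π) (ℕP.≤-reflexive e)) (subst (λ z → take z b ≡ b) (sym e) (take-length b))) (PP.map⁺ (at b) p)

-- asComp β ≤C A, in a form that computes on β (Consecutive⇒≤C, ≤C⇒Consecutive).
Consecutive : List ℕ → SetComp → Set
Consecutive β [] = β ≡ []
Consecutive β (a ∷ A) = (0 < length a) × (take (length a) β ↭ a) × Consecutive (drop (length a) β) A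

concat-asComp : ∀ (b : List ℕ) → concat (asComp b) ≡ b
concat-asComp [] = refl
concat-asComp (x ∷ b) = cong (x ∷_) (concat-asComp b)

asComp-split : ∀ k (β : List ℕ) → asComp (take k β) ++ asComp (drop k β) ≡ asComp β
asComp-split k β = trans (sym (LP.map-++ [_] (take k β) (drop k β))) (cong asComp (LP.take++drop≡id k β))

Consecutive⇒≤C : ∀ β A → Consecutive β A → asComp β ≤C A
Consecutive⇒≤C β [] refl = []≤
Consecutive⇒≤C β (a ∷ A) (pos , pm , sg) = subst (_≤C (a ∷ A)) (asComp-split (length a) β)
   (merge nonempty (subst (_↭ a) (sym (concat-asComp _)) pm) (Consecutive⇒≤C (drop (length a) β) A sg))
  where
  nonempty : asComp (take (length a) β) ≢ []
  nonempty e = ℕP.<⇒≢ pos (trans (sym (cong length (asComp≡[] e))) (PP.↭-length pm))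
    where
    asComp≡[] : ∀ {t : List ℕ} → asComp t ≡ [] → t ≡ []
    asComp≡[] {[]} _ = refl
    asComp≡[] {_ ∷ _} ()

++-asComp⁻ : ∀ (As rest : SetComp) (β : List ℕ) → As ++ rest ≡ asComp β → As ≡ asComp (take (length As) β) × rest ≡ asComp (drop (length As) β)
++-asComp⁻ [] rest β e = refl , e
++-asComp⁻ (a ∷ As) rest (x ∷ β) e with LP.∷-injective e
... | refl , e' = let (p , q) = ++-asComp⁻ As rest β e' in cong ([ x ] ∷_) p , q

length-asComp : ∀ (b : List ℕ) → length (asComp b) ≡ length b
length-asComp b = LP.length-map [_] b

≤C⇒Consecutive : ∀ {X A} → X ≤C A → ∀ β → X ≡ asComp β → Consecutive β A
≤C⇒Consecutive []≤ [] e = refl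
≤C⇒Consecutive (merge {As} {rest} {b} ne cp r) β e = pos , head↭ , tail
  where
  parts = ++-asComp⁻ As rest β e
  k = length As
  |b| : length b ≡ length (take k β)
  |b| = trans (sym (PP.↭-length cp)) (trans (cong (length ∘ concat) (proj₁ parts)) (cong length (concat-asComp (take k β))))
  |take| : length (take k β) ≡ k
  |take| = trans (sym (length-asComp (take k β))) (cong length (sym (proj₁ parts)))
  |b|≡k : length b ≡ k
  |b|≡k = trans |b| |take|
  pos : 0 < length b
  pos = subst (0 <_) (sym |b|≡k) (nonempty As ne)
    where
    nonempty : ∀ (xs : SetComp) → xs ≢ [] → 0 < length xs
    nonempty [] n = ⊥-elim (n refl)
    nonempty (_ ∷ _) _ = s≤s z≤n
  head↭ : take (length b) β ↭ b
  head↭ = subst (λ z → take z β ↭ b) (sym |b|≡k) (subst (_↭ b) (trans (cong concat (proj₁ parts)) (concat-asComp (take k β))) cp)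
  tail : Consecutive (drop (length b) β) _
  tail = subst (λ z → Consecutive (drop z β) _) (sym |b|≡k) (≤C⇒Consecutive r (drop k β) (proj₂ parts))

IrreducibleWord : List ℕ → Set
IrreducibleWord π = Irreducible π × Unique π

take-+ : ∀ a c (β : List ℕ) → take (a ℕ.+ c) β ≡ take a β ++ take c (drop a β)
take-+ zero c β = refl
take-+ (suc a) zero [] = refl
take-+ (suc a) (suc c) [] = refl
take-+ (suc a) c (x ∷ β) = cong (x ∷_) (take-+ a c β)

drop-+ : ∀ a c (β : List ℕ) → drop (a ℕ.+ c) β ≡ drop c (drop a β)
drop-+ a c β = sym (LP.drop-drop a c β)

take-++-short : ∀ c (u v : List ℕ) → c ≤ length u → take c (u ++ v) ≡ take c u
take-++-short zero u v le = refl
take-++-short (suc c) (x ∷ u) v (s≤s le) = cong (x ∷_) (take-++-short c u v le)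

take-take-≤ : ∀ c a (β : List ℕ) → c ≤ a → take c (take a β) ≡ take c β
take-take-≤ zero a β le = refl
take-take-≤ (suc c) (suc a) [] le = refl
take-take-≤ (suc c) (suc a) (x ∷ β) (s≤s le) = cong (x ∷_) (take-take-≤ c a β le)

length-take-≤ : ∀ c (β : List ℕ) → c ≤ length β → length (take c β) ≡ c
length-take-≤ c β le = trans (LP.length-take c β) (ℕP.m≤n⇒m⊓n≡m le)

length-drop : ∀ c (β : List ℕ) → length (drop c β) ≡ length β ∸ c
length-drop c β = LP.length-drop c β

++-cancel↭ : ∀ (xs : List ℕ) {ys zs} → xs ++ ys ↭ xs ++ zs → ys ↭ zs
++-cancel↭ [] p = p
++-cancel↭ (x ∷ xs) p = ++-cancel↭ xs (PP.drop-∷ p)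

Any⇒∈ : ∀ {P : ℕ → Set} {xs : List ℕ} → Any P xs → Σ ℕ λ z → z ∈ xs × P z
Any⇒∈ (here p) = _ , here refl , p
Any⇒∈ (there a) = let (z , m , p) = Any⇒∈ a in z , there m , p

∈-take : ∀ {z} {k} {xs : List ℕ} → z ∈ take k xs → z ∈ xs
∈-take {k = suc k} {x ∷ xs} (here e) = here e
∈-take {k = suc k} {x ∷ xs} (there m) = there (∈-take m)

∈-drop : ∀ {z} c (xs : List ℕ) → z ∈ drop c xs → z ∈ xs
∈-drop zero xs m = m
∈-drop (suc c) (y ∷ ys) m = there (∈-drop c ys m)

take-drop-disjoint : ∀ {z} c (xs : List ℕ) → Unique xs → z ∈ take c xs → z ∈ drop c xs → ⊥
take-drop-disjoint (suc c) (x ∷ xs) (ux ∷ u) (here refl) m2 = All.lookup ux (∈-drop c xs m2) refl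
take-drop-disjoint (suc c) (x ∷ xs) (ux ∷ u) (there m1) m2 = take-drop-disjoint c xs u m1 m2

at-∈ : ∀ (b : List ℕ) j → 1 ≤ j → j ≤ length b → at b j ∈ b
at-∈ (x ∷ b) (suc zero) _ _ = here refl
at-∈ (x ∷ b) (suc (suc j)) _ (s≤s le) = there (at-∈ b (suc j) (s≤s z≤n) le)

at-inj : ∀ (b : List ℕ) {x y} → Unique b → 1 ≤ x → x ≤ length b → 1 ≤ y → y ≤ length b → at b x ≡ at b y → x ≡ y
at-inj (z ∷ b) {suc zero} {suc zero} u _ _ _ _ e = refl
at-inj (z ∷ b) {suc zero} {suc (suc y)} (uz ∷ u) _ _ _ (s≤s ly) e = ⊥-elim (All.lookup uz (at-∈ b (suc y) (s≤s z≤n) ly) (e))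
at-inj (z ∷ b) {suc (suc x)} {suc zero} (uz ∷ u) _ (s≤s lx) _ _ e = ⊥-elim (All.lookup uz (at-∈ b (suc x) (s≤s z≤n) lx) (sym e))
at-inj (z ∷ b) {suc (suc x)} {suc (suc y)} (uz ∷ u) _ (s≤s lx) _ (s≤s ly) e = cong suc (at-inj b u (s≤s z≤n) lx (s≤s z≤n) ly e)

irreducible-bounds : ∀ {π} → Irreducible π → All (λ x → 1 ≤ x × x ≤ length π) π
irreducible-bounds i = proj₁ (proj₂ i)

irreducible-↭-range : ∀ {π} → Irreducible π → Unique π → π ↭ range (length π)
irreducible-↭-range {π} i u = same-elements⇒↭ u (range-unique (length π)) ⊆range (length-≤⇒⊇ u ⊆range (ℕP.≤-reflexive (length-range (length π))))
  where
  ⊆range : ∀ {x} → x ∈ π → x ∈ range (length π)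
  ⊆range m = ∈-range⁺ (proj₁ (All.lookup (irreducible-bounds i) m)) (proj₂ (All.lookup (irreducible-bounds i) m))

prod-positive : ∀ ps → All IrreducibleWord ps → All (1 ≤_) (prod ps)
prod-positive [] _ = []
prod-positive (π ∷ ps) (i ∷ is) = AllP.++⁺ (All.map proj₁ (irreducible-bounds (proj₁ i))) (AllP.map⁺ (All.map (λ {x} p → ℕP.≤-trans p (ℕP.m≤m+n x _)) (prod-positive ps is)))

length-compose : ∀ b π → length (compose b π) ≡ length π
length-compose b π = LP.length-map (at b) π

-- An irreducible π fixes no initial segment {1,…,c}, 0 < c < |π|, so b and b ∘ π cannot share
-- the set of their first c letters.
irreducible-no-common-prefix : ∀ b π c → Unique b → length b ≡ length π → Irreducible π → Unique π → 0 < c → c < length π →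
  ¬ (take c b ↭ take c (compose b π))
irreducible-no-common-prefix b π c ub lb iπ uπ 0<c c<π p with Any⇒∈ (proj₂ (proj₂ iπ) c 0<c c<π)
... | z , z∈ , z≤c = take-drop-disjoint c π uπ (range⊆take (∈-range⁺ (proj₁ (All.lookup (irreducible-bounds iπ) (∈-drop c π z∈))) z≤c)) z∈
  where
  c≤b : c ≤ length b
  c≤b = subst (c ≤_) (sym lb) (ℕP.<⇒≤ c<π)
  images : map (at b) (range c) ↭ map (at b) (take c π)
  images = subst₂ _↭_ (sym (map-at-range b c c≤b)) (LP.take-map c π) p
  range⊆take : ∀ {y} → y ∈ range c → y ∈ take c π
  range⊆take {y} y∈ with ∈-map⁻ (at b) (PP.∈-resp-↭ images (∈-map⁺ (at b) y∈))
  ... | x , x∈ , e = subst (_∈ take c π) (sym (at-inj b ub (proj₁ (∈-range⁻ y∈)) (ℕP.≤-trans (proj₂ (∈-range⁻ y∈)) c≤b)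
           (proj₁ x-bounds) (subst (x ≤_) (sym lb) (proj₂ x-bounds)) e)) x∈
    where
    x-bounds : 1 ≤ x × x ≤ length π
    x-bounds = All.lookup (irreducible-bounds iπ) (∈-take x∈)

common-prefix⇒factor-boundary : ∀ β ps → Unique β → length β ≡ size ps → All IrreducibleWord ps → ∀ c → 0 < c → c ≤ length β →
     take c β ↭ take c (compose β (prod ps)) → Σ ℕ λ j → (0 < j) × (size (take j ps) ≡ c)
common-prefix⇒factor-boundary β [] u lβ ips c pos le p = ⊥-elim (ℕP.<⇒≱ pos (subst (c ≤_) lβ le))
common-prefix⇒factor-boundary β (π ∷ ps) u lβ ((iπ , uπ) ∷ ips) c pos le p with ℕP.<-cmp c (length π)
... | tri≈ _ eq _ = 1 , s≤s z≤n , trans (ℕP.+-identityʳ _) (sym eq)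
... | tri< c<π _ _ = ⊥-elim (irreducible-no-common-prefix b π c (UP.take⁺ (length π) u) lb iπ uπ pos c<π
      (subst₂ _↭_ (sym (take-take-≤ c (length π) β (ℕP.<⇒≤ c<π)))
        (trans (cong (take c) (compose-split β π (prod ps) (irreducible-bounds iπ) (prod-positive ps ips)))
               (take-++-short c (compose b π) _ (subst (c ≤_) (sym (length-compose b π)) (ℕP.<⇒≤ c<π)))) p))
  where
  b = take (length π) β
  lb : length b ≡ length π
  lb = length-take-≤ (length π) β (subst (length π ≤_) (sym lβ) (ℕP.m≤m+n _ _))
... | tri> _ _ gt = let (j' , pj , ej) = ih in suc j' , s≤s z≤n , trans (cong (length π ℕ.+_) ej) ec
  where
  c' = c ∸ length π
  ec : length π ℕ.+ c' ≡ c
  ec = ℕP.m+[n∸m]≡n (ℕP.<⇒≤ gt)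
  b = take (length π) β
  β' = drop (length π) β
  δ' = compose β' (prod ps)
  lπβ : length π ≤ length β
  lπβ = subst (length π ≤_) (sym lβ) (ℕP.m≤m+n _ _)
  lb : length b ≡ length π
  lb = length-take-≤ (length π) β lπβ
  lβ' : length β' ≡ size ps
  lβ' = trans (length-drop (length π) β) (trans (cong (_∸ length π) lβ) (ℕP.m+n∸m≡n (length π) (size ps)))
  δsplit = compose-split β π (prod ps) (irreducible-bounds iπ) (prod-positive ps ips)
  t1 : take c β ≡ b ++ take c' β'
  t1 = trans (cong (λ z → take z β) (sym ec)) (take-+ (length π) c' β)
  t2 : take c (compose β (prod (π ∷ ps))) ≡ compose b π ++ take c' δ'
  t2 = trans (cong (take c) δsplit) (trans (cong (λ z → take z (compose b π ++ δ')) (trans (sym ec) (cong (ℕ._+ c') (sym (length-compose b π))))) (take-app-sum (compose b π) δ' c'))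
    where
    take-app-sum : ∀ (u v : List ℕ) k → take (length u ℕ.+ k) (u ++ v) ≡ u ++ take k v
    take-app-sum [] v k = refl
    take-app-sum (x ∷ u) v k = cong (x ∷_) (take-app-sum u v k)
  cb : compose b π ↭ b
  cb = compose-perm b π (sym lb) (irreducible-↭-range iπ uπ)
  p' : take c' β' ↭ take c' δ'
  p' = ++-cancel↭ b (↭-trans (subst (_↭ (compose b π ++ take c' δ')) t1 (subst (take c β ↭_) t2 p)) (PP.++⁺ʳ (take c' δ') cb))
  ih = common-prefix⇒factor-boundary β' ps (UP.drop⁺ (length π) u) lβ' ips c' (ℕP.m<n⇒0<n∸m gt) (subst (c' ≤_) (sym (length-drop (length π) β)) (ℕP.∸-monoˡ-≤ (length π) le)) p'

drop-take : ∀ a c (β : List ℕ) → drop a (take (a ℕ.+ c) β) ≡ take c (drop a β)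
drop-take zero c β = refl
drop-take (suc a) zero [] = refl
drop-take (suc a) (suc c) [] = refl
drop-take (suc a) c (x ∷ β) = drop-take a c β

drop-++-length : ∀ (u v : List ℕ) k → length u ≡ k → drop k (u ++ v) ≡ v
drop-++-length u v k refl = drop-length-++ u v

length≡0 : ∀ {β : List ℕ} → length β ≡ 0 → β ≡ []
length≡0 {[]} _ = refl

size≡0 : ∀ ps → All IrreducibleWord ps → size ps ≡ 0 → ps ≡ []
size≡0 [] _ _ = refl
size≡0 (π ∷ ps) ((i , _) ∷ _) e = ⊥-elim (ℕP.<⇒≢ (ℕP.<-≤-trans (proj₁ i) (ℕP.m≤m+n _ _)) (sym e))

length-take⇒≤ : ∀ c (β : List ℕ) → length (take c β) ≡ c → c ≤ length β
length-take⇒≤ c β e = subst (_≤ length β) e (subst (_≤ length β) (sym (LP.length-take c β)) (ℕP.m⊓n≤n c (length β)))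

blocks-split : ∀ j β ps → blocks β ps ≡ blocks (take (size (take j ps)) β) (take j ps) ++ blocks (drop (size (take j ps)) β) (drop j ps)
blocks-split zero β ps = refl
blocks-split (suc j) β [] = refl
blocks-split (suc j) β (π ∷ ps) = cong₂ _∷_ (sym (take-take-≤ (length π) (length π ℕ.+ s) β (ℕP.m≤m+n _ _)))
  (trans (blocks-split j (drop (length π) β) ps) (cong₂ _++_
     (cong (λ z → blocks z (take j ps)) (sym (drop-take (length π) s β)))
     (cong (λ z → blocks z (drop j ps)) (sym (drop-+ (length π) s β)))))
  where
  s = size (take j ps)

concat-blocks : ∀ β ps → length β ≡ size ps → concat (blocks β ps) ≡ β
concat-blocks β [] e = sym (length≡0 e)
concat-blocks β (π ∷ ps) e = trans (cong (take (length π) β ++_) (concat-blocks (drop (length π) β) ps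
   (trans (length-drop (length π) β) (trans (cong (_∸ length π) e) (ℕP.m+n∸m≡n (length π) (size ps)))))) (LP.take++drop≡id (length π) β)

length-drop-factor : ∀ (β π : List ℕ) (ps : List (List ℕ)) → length β ≡ length π ℕ.+ size ps → length (drop (length π) β) ≡ size ps
length-drop-factor β π ps e = trans (length-drop (length π) β) (trans (cong (_∸ length π) e) (ℕP.m+n∸m≡n (length π) (size ps)))

compose-prod-split : ∀ j β ps → All IrreducibleWord ps → compose β (prod ps) ≡
   compose (take (size (take j ps)) β) (prod (take j ps)) ++ compose (drop (size (take j ps)) β) (prod (drop j ps))
compose-prod-split zero β ps _ = refl
compose-prod-split (suc j) β [] _ = refl
compose-prod-split (suc j) β (π ∷ ps) ((iπ , uπ) ∷ ips) =
  trans (compose-split β π (prod ps) (irreducible-bounds iπ) (prod-positive ps ips))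
  (trans (cong (compose (take (length π) β) π ++_) (compose-prod-split j (drop (length π) β) ps ips))
  (trans (sym (LP.++-assoc (compose (take (length π) β) π) _ _))
   (cong₂ _++_ (sym (trans (compose-split (take (length π ℕ.+ s) β) π (prod (take j ps)) (irreducible-bounds iπ) (prod-positive (take j ps) (AllP.take⁺ j ips)))
        (cong₂ _++_ (cong (λ z → compose z π) (take-take-≤ (length π) (length π ℕ.+ s) β (ℕP.m≤m+n _ _)))
                     (cong (λ z → compose z (prod (take j ps))) (drop-take (length π) s β)))))
     (cong (λ z → compose z (prod (drop j ps))) (sym (drop-+ (length π) s β))))))
  where
  s = size (take j ps)

Consecutive-blocks : ∀ β ps → length β ≡ size ps → All IrreducibleWord ps → Consecutive β (blocks β ps)
Consecutive-blocks β [] e _ = length≡0 e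
Consecutive-blocks β (π ∷ ps) e ((iπ , _) ∷ ips) = subst (0 <_) (sym |take|) (proj₁ iπ) ,
   subst (λ z → take z β ↭ take (length π) β) (sym |take|) ↭-refl ,
   subst (λ z → Consecutive (drop z β) (blocks (drop (length π) β) ps)) (sym |take|) (Consecutive-blocks (drop (length π) β) ps (length-drop-factor β π ps e) ips)
  where
  |take| : length (take (length π) β) ≡ length π
  |take| = length-take-≤ (length π) β (subst (length π ≤_) (sym e) (ℕP.m≤m+n _ _))

Consecutive-blocks-compose : ∀ β ps → length β ≡ size ps → All IrreducibleWord ps → Consecutive (compose β (prod ps)) (blocks β ps)
Consecutive-blocks-compose β [] e _ = refl
Consecutive-blocks-compose β (π ∷ ps) e ((iπ , uπ) ∷ ips) = subst (0 <_) (sym |b|) (proj₁ iπ) , head , tail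
  where
  b = take (length π) β
  |b| : length b ≡ length π
  |b| = length-take-≤ (length π) β (subst (length π ≤_) (sym e) (ℕP.m≤m+n _ _))
  split = compose-split β π (prod ps) (irreducible-bounds iπ) (prod-positive ps ips)
  head : take (length b) (compose β (prod (π ∷ ps))) ↭ b
  head = subst (_↭ b) (sym (trans (cong (take (length b)) split) (trans (take-++-short (length b) (compose b π) _ (ℕP.≤-reflexive (trans |b| (sym (length-compose b π)))))
         (trans (cong (λ z → take z (compose b π)) (trans |b| (sym (length-compose b π)))) (take-length (compose b π))))))
         (compose-perm b π (sym |b|) (irreducible-↭-range iπ uπ))
  tail : Consecutive (drop (length b) (compose β (prod (π ∷ ps)))) (blocks (drop (length π) β) ps)
  tail = subst (λ z → Consecutive z (blocks (drop (length π) β) ps)) (sym (trans (cong (drop (length b)) split) (drop-++-length (compose b π) _ (length b) (trans (length-compose b π) (sym |b|)))))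
         (Consecutive-blocks-compose (drop (length π) β) ps (length-drop-factor β π ps e) ips)

blocks-least : ∀ A β ps → Unique β → length β ≡ size ps → All IrreducibleWord ps → Consecutive β A → Consecutive (compose β (prod ps)) A → blocks β ps ≤C A
blocks-least [] β ps u lβ ips refl _ with size≡0 ps ips (sym lβ)
... | refl = []≤
blocks-least (a ∷ A) β ps u lβ ips (pos , head-β , tail-β) (_ , head-δ , tail-δ₀) =
  subst (_≤C (a ∷ A)) (sym (blocks-split j β ps)) (merge nonempty concat-head tail)
  where
  c = length a
  common : take c β ↭ take c (compose β (prod ps))
  common = ↭-trans head-β (↭-sym head-δ)
  c≤β : c ≤ length β
  c≤β = length-take⇒≤ c β (PP.↭-length head-β)
  boundary = common-prefix⇒factor-boundary β ps u lβ ips c pos c≤β common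
  j = proj₁ boundary
  size-head : size (take j ps) ≡ c
  size-head = proj₂ (proj₂ boundary)
  nonempty : blocks (take (size (take j ps)) β) (take j ps) ≢ []
  nonempty e = ℕP.<⇒≢ pos (trans (sym (cong size (blocks≡[] _ (take j ps) e))) size-head)
    where
    blocks≡[] : ∀ β ps → blocks β ps ≡ [] → ps ≡ []
    blocks≡[] β [] _ = refl
    blocks≡[] β (_ ∷ _) ()
  concat-head : concat (blocks (take (size (take j ps)) β) (take j ps)) ↭ a
  concat-head = subst (_↭ a) (sym (trans (concat-blocks _ (take j ps) (trans (length-take-≤ _ β (subst (_≤ length β) (sym size-head) c≤β)) refl))
         (cong (λ z → take z β) size-head))) head-β
  |tail| : length (drop c β) ≡ size (drop j ps)
  |tail| = trans (length-drop c β) (trans (cong (_∸ c) (trans lβ (size-take-drop j ps))) (trans (cong (λ z → z ℕ.+ size (drop j ps) ∸ c) size-head) (ℕP.m+n∸m≡n c _)))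
    where
    size-take-drop : ∀ j ps → size ps ≡ size (take j ps) ℕ.+ size (drop j ps)
    size-take-drop zero ps = refl
    size-take-drop (suc j) [] = refl
    size-take-drop (suc j) (π ∷ ps) = trans (cong (length π ℕ.+_) (size-take-drop j ps)) (sym (ℕP.+-assoc (length π) _ _))
  tail-δ : Consecutive (compose (drop c β) (prod (drop j ps))) A
  tail-δ = subst (λ z → Consecutive z A) (trans (cong (drop c) (compose-prod-split j β ps ips))
          (trans (drop-++-length (compose (take (size (take j ps)) β) (prod (take j ps))) (compose (drop (size (take j ps)) β) (prod (drop j ps))) c (trans (length-compose (take (size (take j ps)) β) (prod (take j ps))) (trans (length-prod (take j ps)) size-head)))
            (cong (λ z → compose (drop z β) (prod (drop j ps))) size-head))) tail-δ₀
  tail : blocks (drop (size (take j ps)) β) (drop j ps) ≤C A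
  tail = subst (λ z → blocks (drop z β) (drop j ps) ≤C A) (sym size-head)
    (blocks-least A (drop c β) (drop j ps) (UP.drop⁺ c u) |tail| (AllP.drop⁺ j ips) tail-β tail-δ)

≤C-length : ∀ {A B} → A ≤C B → length B ≤ length A
≤C-length []≤ = z≤n
≤C-length (merge {As} {rest} ne _ r) = subst (_ ≤_) (sym (LP.length-++ As)) (nonempty As ne (≤C-length r))
  where
  nonempty : ∀ (xs : SetComp) {m k} → xs ≢ [] → m ≤ k → suc m ≤ length xs ℕ.+ k
  nonempty [] n _ = ⊥-elim (n refl)
  nonempty (_ ∷ xs) n le = s≤s (ℕP.≤-trans le (ℕP.m≤n+m _ (length xs)))

≤C-equal-length : ∀ {A B} → A ≤C B → length A ≡ length B → Pointwise _↭_ A B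
≤C-equal-length []≤ _ = []
≤C-equal-length (merge {[]} ne _ _) _ = ⊥-elim (ne refl)
≤C-equal-length (merge {a ∷ []} {rest} {b} ne cp r) e = subst (_↭ b) (LP.++-identityʳ a) cp ∷ ≤C-equal-length r (ℕP.suc-injective e)
≤C-equal-length (merge {a ∷ a' ∷ As} {rest} {b} {Bs} ne cp r) e = ⊥-elim (ℕP.<⇒≱ too-long (≤C-length r))
  where
  too-long : suc (length rest) ≤ length Bs
  too-long = subst (suc (length rest) ≤_) (ℕP.suc-injective e) (s≤s (subst (length rest ≤_) (sym (LP.length-++ As)) (ℕP.m≤n+m _ (length As))))

≤C-antisym : ∀ {A B} → A ≤C B → B ≤C A → Pointwise _↭_ A B
≤C-antisym p q = ≤C-equal-length p (ℕP.≤-antisym (≤C-length q) (≤C-length p))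

module _ (β : List ℕ) (ps : List (List ℕ)) (u : Unique β) (lβ : length β ≡ size ps) (ips : All IrreducibleWord ps) where
  private
    δ = compose β (prod ps)

  blocks-isJoin : IsJoin β δ (blocks β ps)
  blocks-isJoin = Consecutive⇒≤C β _ (Consecutive-blocks β ps lβ ips) , Consecutive⇒≤C δ _ (Consecutive-blocks-compose β ps lβ ips) ,
     (λ A p q → blocks-least A β ps u lβ ips (≤C⇒Consecutive p β refl) (≤C⇒Consecutive q δ refl))

  join-unique : ∀ Λ → IsJoin β δ Λ → Pointwise _↭_ Λ (blocks β ps)
  join-unique Λ (j1 , j2 , j3) = ≤C-antisym (j3 (blocks β ps) (proj₁ blocks-isJoin) (proj₁ (proj₂ blocks-isJoin)))
     (blocks-least Λ β ps u lβ ips (≤C⇒Consecutive j1 β refl) (≤C⇒Consecutive j2 δ refl))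

Pointwise-All : ∀ {P : List ℕ → Set} → (∀ {a b} → a ↭ b → P a → P b) → ∀ {A B} → Pointwise _↭_ A B → All P A → All P B
Pointwise-All f [] [] = []
Pointwise-All f (x ∷ q) (pa ∷ pas) = f x pa ∷ Pointwise-All f q pas

Pointwise-AllAdj : ∀ {R : List ℕ → List ℕ → Set} → (∀ {a b c d} → a ↭ b → c ↭ d → R a c → R b d) → ∀ {A B} → Pointwise _↭_ A B → AllAdj R A → AllAdj R B
Pointwise-AllAdj f [] _ = _
Pointwise-AllAdj f (x ∷ []) _ = _
Pointwise-AllAdj f (x ∷ y ∷ q) (r , rs) = f x y r , Pointwise-AllAdj f (y ∷ q) rs

IncEps-↭ : ∀ {β a b} → a ↭ b → IncEps β a → IncEps β b
IncEps-↭ p f mx my lt = f (PP.∈-resp-↭ (↭-sym p) mx) (PP.∈-resp-↭ (↭-sym p) my) lt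

IncAlpha-↭ : ∀ {α w a b} → a ↭ b → IncAlpha α w a → IncAlpha α w b
IncAlpha-↭ p f mx my bf = f (PP.∈-resp-↭ (↭-sym p) mx) (PP.∈-resp-↭ (↭-sym p) my) bf

Cond3-↭ : ∀ {α a b c d} → a ↭ b → c ↭ d → Cond3 α a c → Cond3 α b d
Cond3-↭ p q (inj₁ (x , y , mx , my , lt)) = inj₁ (x , y , PP.∈-resp-↭ p mx , PP.∈-resp-↭ q my , lt)
Cond3-↭ p q (inj₂ (x , y , mx , my , bf)) = inj₂ (x , y , PP.∈-resp-↭ p mx , PP.∈-resp-↭ q my , bf)

-- Positions in a word

position : List ℕ → ℕ → ℕ
position [] x = 0
position (y ∷ ys) x with x ≟ y
... | yes _ = 0
... | no _ = suc (position ys x)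

position-++-∉ : ∀ {x} (u : List ℕ) v → x ∉ u → position (u ++ v) x ≡ length u ℕ.+ position v x
position-++-∉ [] v _ = refl
position-++-∉ {x} (y ∷ u) v nm with x ≟ y
... | yes refl = ⊥-elim (nm (here refl))
... | no _ = cong suc (position-++-∉ u v (λ m → nm (there m)))

position-head : ∀ x v → position (x ∷ v) x ≡ 0
position-head x v with x ≟ x
... | yes _ = refl
... | no ne = ⊥-elim (ne refl)

Unique-middle : ∀ {x} (u v : List ℕ) → Unique (u ++ x ∷ v) → x ∉ u × x ∉ v
Unique-middle [] v (ux ∷ _) = (λ ()) , (λ m → All.lookup ux m refl)
Unique-middle {x} (y ∷ u) v (uy ∷ uu) = (λ { (here e) → All.lookup uy (∈-++⁺ʳ u (here refl)) (sym e) ; (there m) → proj₁ (Unique-middle u v uu) m }) , proj₂ (Unique-middle u v uu)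

Before⇒position-< : ∀ {w x y} → Unique w → Before w x y → position w x < position w y
Before⇒position-< {w} {x} {y} uw (u , v , refl , my) with Unique-middle u v uw
... | x∉u , x∉v = subst₂ _<_ (sym (position-++-∉ u (x ∷ v) x∉u)) (sym (position-++-∉ u (x ∷ v) y∉u)) (ℕP.+-monoʳ-< (length u) x-first)
  where
  y∉u : y ∉ u
  y∉u m = ⊥-elim (not-both-sides u v uw m my)
    where
    not-both-sides : ∀ {y x} (u v : List ℕ) → Unique (u ++ x ∷ v) → y ∈ u → y ∈ v → ⊥
    not-both-sides (z ∷ u) v (uz ∷ uu) (here refl) my = All.lookup uz (∈-++⁺ʳ u (there my)) refl
    not-both-sides (z ∷ u) v (uz ∷ uu) (there m) my = not-both-sides u v uu m my
  x-first : position (x ∷ v) x < position (x ∷ v) y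
  x-first with y ≟ x
  ... | yes refl = ⊥-elim (x∉v my)
  ... | no _ = subst (_< suc (position v y)) (sym (position-head x v)) (s≤s z≤n)

position-<⇒Before : ∀ {w x y} → x ∈ w → y ∈ w → position w x < position w y → Before w x y
position-<⇒Before {z ∷ w} {x} {y} mx my lt with x ≟ z | y ≟ z
position-<⇒Before {z ∷ w} {x} {y} mx my () | _ | yes _
position-<⇒Before {z ∷ w} {x} {y} mx (here e) lt | yes refl | no ne = ⊥-elim (ne e)
position-<⇒Before {z ∷ w} {x} {y} mx (there my) lt | yes refl | no _ = [] , w , refl , my
position-<⇒Before {z ∷ w} {x} {y} (here e) my lt | no ne | no _ = ⊥-elim (ne e)
position-<⇒Before {z ∷ w} {x} {y} (there mx) (here e) lt | no _ | no ne = ⊥-elim (ne e)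
position-<⇒Before {z ∷ w} {x} {y} (there mx) (there my) (s≤s lt) | no _ | no _ with position-<⇒Before mx my lt
... | u , v , refl , m = z ∷ u , v , refl , m

Before-∈ : ∀ {w x y} → Before w x y → x ∈ w × y ∈ w
Before-∈ (u , v , refl , my) = ∈-++⁺ʳ u (here refl) , ∈-++⁺ʳ u (there my)

Before-asym : ∀ {w x y} → Unique w → Before w x y → Before w y x → ⊥
Before-asym uw b1 b2 = ℕP.<-asym (Before⇒position-< uw b1) (Before⇒position-< uw b2)

position-injective : ∀ {w x y} → x ∈ w → y ∈ w → position w x ≡ position w y → x ≡ y
position-injective {z ∷ w} {x} {y} mx my e with x ≟ z | y ≟ z
... | yes refl | yes refl = refl
position-injective {z ∷ w} {x} {y} mx my () | yes refl | no _
position-injective {z ∷ w} {x} {y} mx my () | no _ | yes refl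
position-injective {z ∷ w} {x} {y} (here e) my _ | no ne | no _ = ⊥-elim (ne e)
position-injective {z ∷ w} {x} {y} (there mx) (here e) _ | no _ | no ne = ⊥-elim (ne e)
position-injective {z ∷ w} {x} {y} (there mx) (there my) e | no _ | no _ = position-injective mx my (ℕP.suc-injective e)

Before-total : ∀ {w x y} → x ∈ w → y ∈ w → x ≢ y → Before w x y ⊎ Before w y x
Before-total {w} {x} {y} mx my ne with ℕP.<-cmp (position w x) (position w y)
... | tri< lt _ _ = inj₁ (position-<⇒Before mx my lt)
... | tri≈ _ eq _ = ⊥-elim (ne (position-injective mx my eq))
... | tri> _ _ gt = inj₂ (position-<⇒Before my mx gt)

Before-infix : ∀ {a x y} (u v : List ℕ) → Before a x y → Before (u ++ a ++ v) x y
Before-infix {a} {x} {y} u v (u' , v' , refl , my) = u ++ u' , v' ++ v ,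
   trans (cong (u ++_) (LP.++-assoc u' (x ∷ v') v)) (sym (LP.++-assoc u u' (x ∷ v' ++ v))) , ∈-++⁺ˡ my

AllPairs-Before : ∀ {R : ℕ → ℕ → Set} {w x y} → AllPairs R w → Before w x y → R x y
AllPairs-Before {R} {w} {x} {y} ap (u , v , refl , my) = All.lookup (headAll u ap) my
  where
  headAll : ∀ (u : List ℕ) {v} → AllPairs R (u ++ x ∷ v) → All (R x) v
  headAll [] (px ∷ _) = px
  headAll (z ∷ u) (_ ∷ ap') = headAll u ap'

Increasing-position : ∀ (α : List ℕ) → Unique α → AllPairs (λ a b → position α a < position α b) α
Increasing-position α u = suffix-increasing [] α refl
  where
  suffix-increasing : ∀ (pre rest : List ℕ) → pre ++ rest ≡ α → AllPairs (λ a b → position α a < position α b) rest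
  suffix-increasing pre [] e = []
  suffix-increasing pre (z ∷ rest) e = All.tabulate (λ {y} my → Before⇒position-< u (pre , rest , sym e , my)) ∷ suffix-increasing (pre ++ [ z ]) rest (trans (LP.++-assoc pre [ z ] rest) e)

sort-strict : ∀ {w} → Unique w → AllPairs _<_ (sort w)
sort-strict {w} u = AP.zipWith (λ (le , ne) → ℕP.≤∧≢⇒< le ne) (Linked⇒AllPairs ℕP.≤-trans (sort-↗ w) , Unique-resp-↭ (↭-sym (sort-↭ w)) u)

sorted-↭⇒≡ : ∀ {R : ℕ → ℕ → Set} → (∀ {a b} → R a b → R b a → ⊥) → ∀ {xs ys} → AllPairs R xs → AllPairs R ys → xs ↭ ys → xs ≡ ys
sorted-↭⇒≡ asym {[]} {ys} _ _ p = sym (PP.↭-empty-inv (↭-sym p))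
sorted-↭⇒≡ asym {x ∷ xs} {[]} _ _ p = ⊥-elim (ℕP.<⇒≢ (s≤s z≤n) (sym (PP.↭-length p)))
sorted-↭⇒≡ {R} asym {x ∷ xs} {y ∷ ys} (px ∷ ax) (py ∷ ay) p with PP.∈-resp-↭ p (here refl) | PP.∈-resp-↭ (↭-sym p) (here refl)
... | here refl | _ = cong (x ∷_) (sorted-↭⇒≡ asym ax ay (PP.drop-∷ p))
... | there mx | here refl = cong (x ∷_) (sorted-↭⇒≡ asym ax ay (PP.drop-∷ p))
... | there mx | there my = ⊥-elim (asym (All.lookup px my) (All.lookup py mx))

countLt-↭ : ∀ {x} {xs ys : List ℕ} → xs ↭ ys → countLt x xs ≡ countLt x ys
countLt-↭ {x} {xs} {ys} p = trans (sym (length-filter-< x xs)) (trans (PP.↭-length (PP.filter-↭ (_<? x) p)) (length-filter-< x ys))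

at-rank : ∀ {s x} → AllPairs _<_ s → x ∈ s → at s (suc (countLt x s)) ≡ x
at-rank {y ∷ ys} {x} (py ∷ ap) m with y <? x
at-rank {y ∷ ys} {x} (py ∷ ap) (here refl) | yes lt = ⊥-elim (ℕP.<-irrefl refl lt)
at-rank {y ∷ ys} {x} (py ∷ ap) (there m) | yes lt = at-rank ap m
at-rank {y ∷ ys} {x} (py ∷ ap) (here refl) | no _ = cong (λ z → at (y ∷ ys) (suc z)) (countLt-none y ys py)
at-rank {y ∷ ys} {x} (py ∷ ap) (there m) | no nlt = ⊥-elim (nlt (All.lookup py m))

compose-sort-st : ∀ {w} → Unique w → compose (sort w) (st w) ≡ w
compose-sort-st {w} u = trans (sym (LP.map-∘ w)) (LP.map-id-local (All.tabulate at-sort-rank))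
  where
  at-sort-rank : ∀ {x} → x ∈ w → at (sort w) (rank w x) ≡ x
  at-sort-rank {x} m = trans (cong (at (sort w)) (trans (rank≡suc-countLt w x) (cong suc (countLt-↭ (↭-sym (sort-↭ w)))))) (at-rank (sort-strict u) (PP.∈-resp-↭ (↭-sym (sort-↭ w)) m))

countLt-0 : ∀ (w : List ℕ) → countLt 0 w ≡ 0
countLt-0 [] = refl
countLt-0 (y ∷ w) with y <? 0
... | yes ()
... | no _ = countLt-0 w

countLt-range : ∀ k x → x ≤ suc k → countLt x (range k) ≡ x ∸ 1
countLt-range zero zero _ = refl
countLt-range zero (suc zero) _ = refl
countLt-range zero (suc (suc x)) (s≤s ())
countLt-range (suc k) zero _ = countLt-0 (range (suc k))
countLt-range (suc k) (suc x) (s≤s le) = trans (cong (countLt (suc x)) (range-suc k)) (countLt-1∷ x le)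
  where
  countLt-map-suc : ∀ x → countLt (suc x) (map suc (range k)) ≡ countLt x (range k)
  countLt-map-suc x = countLt-map suc x (range k) (λ _ → s≤s , ℕP.≤-pred)
  countLt-1∷ : ∀ x → x ≤ suc k → countLt (suc x) (1 ∷ map suc (range k)) ≡ suc x ∸ 1
  countLt-1∷ zero le' = trans (countLt-map-suc 0) (countLt-0 (range k))
  countLt-1∷ (suc x) le' = cong suc (trans (countLt-map-suc (suc x)) (countLt-range k (suc x) le'))

st-permutation : ∀ {π} → π ↭ range (length π) → st π ≡ π
st-permutation {π} p = LP.map-id-local (All.tabulate rank-self)
  where
  rank-self : ∀ {x} → x ∈ π → rank π x ≡ x
  rank-self {x} m with ∈-range⁻ (PP.∈-resp-↭ p m)
  ... | lo , hi = trans (rank≡suc-countLt π x) (trans (cong suc (trans (countLt-↭ p) (countLt-range (length π) x (ℕP.m≤n⇒m≤1+n hi)))) (suc-pred x lo))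
    where
    suc-pred : ∀ x → 1 ≤ x → suc (x ∸ 1) ≡ x
    suc-pred (suc x) _ = refl

-- Chains as lists of blocks

whenL : ∀ {P : Set} {A : Set} → Dec P → List A → List A
whenL (yes _) xs = xs
whenL (no _) _ = []

unlessL : ∀ {P : Set} {A : Set} → Dec P → List A → List A
unlessL (yes _) _ = []
unlessL (no _) xs = xs

chainsEmpty : List ℕ → List SetComp
chainsEmpty [] = [ [] ]
chainsEmpty (_ ∷ _) = []

chains : (ℕ → ℕ) → List ℕ → List (List ℕ) → Maybe (List ℕ) → List SetComp
chains p α [] nb = chainsEmpty α
chains p α (q ∷ qs) nb = concatSplits α (λ l r → whenL (st≟ r q) (unlessL (precedesMaybe? p r nb) (map (_++ [ r ]) (chains p l qs (just r)))))

chainCount≡length-chains : ∀ p α qs nb → chainCount p α qs nb ≡ + length (chains p α qs nb)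
chainCount≡length-chains p [] [] nb = refl
chainCount≡length-chains p (_ ∷ _) [] nb = refl
chainCount≡length-chains p α (q ∷ qs) nb = trans (Σsplits-cong α (λ {l} {r} _ → step-length l r)) (sym (length-concatSplits α _))
  where
  step-length : ∀ l r → when (st≟ r q) (unless (precedesMaybe? p r nb) (chainCount p l qs (just r))) ≡ + length (whenL (st≟ r q) (unlessL (precedesMaybe? p r nb) (map (_++ [ r ]) (chains p l qs (just r)))))
  step-length l r with st≟ r q | precedesMaybe? p r nb
  ... | no _ | _ = refl
  ... | yes _ | yes _ = refl
  ... | yes _ | no _ = trans (chainCount≡length-chains p l qs (just r)) (cong +_ (sym (LP.length-map (_++ [ r ]) (chains p l qs (just r)))))

∈-concatSplits⁻ : ∀ {A : Set} {x : A} w (f : List ℕ → List ℕ → List A) → x ∈ concatSplits w f → Σ (List ℕ) λ l → Σ (List ℕ) λ r → Interleaving l r w × x ∈ f l r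
∈-concatSplits⁻ [] f m = [] , [] , [] , m
∈-concatSplits⁻ (y ∷ ys) f m with ∈-concatSplits⁻ ys _ m
... | l , r , i , m' with ∈-++⁻ (f (y ∷ l) r) m'
...   | inj₁ m1 = y ∷ l , r , consˡ i , m1
...   | inj₂ m2 = l , y ∷ r , consʳ i , m2

∈-concatSplits⁺ : ∀ {A : Set} {x : A} w (f : List ℕ → List ℕ → List A) {l r} → Interleaving l r w → x ∈ f l r → x ∈ concatSplits w f
∈-concatSplits⁺ [] f [] m = m
∈-concatSplits⁺ (y ∷ ys) f (consˡ i) m = ∈-concatSplits⁺ ys (λ l r → f (y ∷ l) r ++ f l (y ∷ r)) i (∈-++⁺ˡ m)
∈-concatSplits⁺ (y ∷ ys) f {l} {_ ∷ r} (consʳ i) m = ∈-concatSplits⁺ ys (λ l r → f (y ∷ l) r ++ f l (y ∷ r)) i (∈-++⁺ʳ (f (y ∷ l) r) m)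

∈-whenL : ∀ {P A : Set} {x : A} (d : Dec P) xs → x ∈ whenL d xs → P × x ∈ xs
∈-whenL (yes p) xs m = p , m
∈-whenL (no _) xs ()

∈-unlessL : ∀ {P A : Set} {x : A} (d : Dec P) xs → x ∈ unlessL d xs → ¬ P × x ∈ xs
∈-unlessL (no ¬p) xs m = ¬p , m
∈-unlessL (yes _) xs ()

maybeToList : Maybe (List ℕ) → SetComp
maybeToList nothing = []
maybeToList (just s) = [ s ]

NotPrecedes : (ℕ → ℕ) → List ℕ → List ℕ → Set
NotPrecedes p w w' = ¬ Precedes p w w'

AllAdj-snoc : ∀ {R : List ℕ → List ℕ → Set} (xs : SetComp) r nb → AllAdj R (xs ++ [ r ]) → (∀ s → nb ≡ just s → R r s) → AllAdj R ((xs ++ [ r ]) ++ maybeToList nb)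
AllAdj-snoc xs r nothing a f = subst (AllAdj _) (sym (LP.++-identityʳ (xs ++ [ r ]))) a
AllAdj-snoc [] r (just s) a f = f s refl , tt
AllAdj-snoc (x ∷ []) r (just s) (a , _) f = a , f s refl , tt
AllAdj-snoc (x ∷ y ∷ xs) r (just s) (a , as) f = a , AllAdj-snoc (y ∷ xs) r (just s) as f

AllAdj-pre : ∀ {R : List ℕ → List ℕ → Set} (xs ys : SetComp) → AllAdj R (xs ++ ys) → AllAdj R xs
AllAdj-pre [] ys _ = tt
AllAdj-pre (x ∷ []) ys _ = tt
AllAdj-pre (x ∷ y ∷ xs) ys (a , as) = a , AllAdj-pre (y ∷ xs) ys as

chains-sound : ∀ p α qs nb B → Increasing p α → B ∈ chains p α qs nb →
    (concat B ↭ α) × (map st B ≡ reverse qs) × All (Increasing p) B × AllAdj (NotPrecedes p) (B ++ maybeToList nb)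
chains-sound p [] [] nb .[] inc (here refl) = ↭-refl , refl , [] , adj-empty nb
  where
  adj-empty : ∀ nb → AllAdj (NotPrecedes p) ([] ++ maybeToList nb)
  adj-empty nothing = tt
  adj-empty (just s) = tt
chains-sound p [] [] nb B inc (there ())
chains-sound p (_ ∷ _) [] nb B inc ()
chains-sound p α (q ∷ qs) nb B inc m with ∈-concatSplits⁻ α _ m
... | l , r , i , m1 with ∈-whenL (st≟ r q) _ m1
...   | st-r , m2 with ∈-unlessL (precedesMaybe? p r nb) _ m2
...     | ¬precedes , m3 with ∈-map⁻ (_++ [ r ]) m3
...       | B' , mB' , refl with chains-sound p l qs (just r) B' (proj₁ (Increasing-interleaving i inc)) mB'
...         | concat-B' , st-B' , inc-B' , adj-B' =
   ↭-trans (subst (_↭ l ++ r) (sym (trans (sym (LP.concat-++ B' [ r ])) (cong (concat B' ++_) (LP.++-identityʳ r)))) (PP.++⁺ʳ r concat-B')) (↭-sym (toPermutation i)) ,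
   trans (LP.map-++ st B' [ r ]) (trans (cong₂ _++_ st-B' (cong [_] st-r)) (sym (LP.unfold-reverse q qs))) ,
   AllP.++⁺ inc-B' (proj₂ (Increasing-interleaving i inc) ∷ []) ,
   AllAdj-snoc B' r nb adj-B' (λ { s refl → ¬precedes })

map-∷ʳ⁻ : ∀ (f : List ℕ → List ℕ) (B : SetComp) xs y → map f B ≡ xs ++ [ y ] →
  Σ SetComp λ B' → Σ (List ℕ) λ r → (B ≡ B' ++ [ r ]) × (map f B' ≡ xs) × (f r ≡ y)
map-∷ʳ⁻ f (b ∷ []) [] y refl = [] , b , refl , refl , refl
map-∷ʳ⁻ f (b ∷ b' ∷ B) [] y ()
map-∷ʳ⁻ f (b ∷ B) (x ∷ xs) y e with LP.∷-injective e
... | e1 , e2 with map-∷ʳ⁻ f B xs y e2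
... | B' , r , refl , e3 , e4 = b ∷ B' , r , refl , cong₂ _∷_ e1 e3 , e4

Unique-++⁻ : ∀ (a : List ℕ) {b} → Unique (a ++ b) → Unique a × Unique b × Disjoint a b
Unique-++⁻ [] u = [] , u , (λ { (() , _) })
Unique-++⁻ (x ∷ a) (ux ∷ u) with Unique-++⁻ a u
... | ua , ub , d = AllP.++⁻ˡ a ux ∷ ua , ub , (λ { (here refl , m2) → All.lookup (AllP.++⁻ʳ a ux) m2 refl ; (there m1 , m2) → d (m1 , m2) })

interleaving-filter : ∀ (r α : List ℕ) → Interleaving (filter (¬? ∘ (_∈? r)) α) (filter (_∈? r) α) α
interleaving-filter r [] = []
interleaving-filter r (x ∷ α) = by-membership (x ∈? r)
  where
  by-membership : Dec (x ∈ r) → Interleaving (filter (¬? ∘ (_∈? r)) (x ∷ α)) (filter (_∈? r) (x ∷ α)) (x ∷ α)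
  by-membership (yes m) rewrite LP.filter-accept (_∈? r) {x} {α} m | LP.filter-reject (¬? ∘ (_∈? r)) {x} {α} (λ nm → nm m) = consʳ (interleaving-filter r α)
  by-membership (no nm) rewrite LP.filter-reject (_∈? r) {x} {α} nm | LP.filter-accept (¬? ∘ (_∈? r)) {x} {α} nm = consˡ (interleaving-filter r α)

AllAdj-last : ∀ {R : List ℕ → List ℕ → Set} (xs : SetComp) r s → AllAdj R ((xs ++ [ r ]) ++ [ s ]) → R r s
AllAdj-last [] r s (a , _) = a
AllAdj-last (x ∷ []) r s (_ , a , _) = a
AllAdj-last (x ∷ y ∷ xs) r s (_ , as) = AllAdj-last (y ∷ xs) r s as

∈-whenL⁺ : ∀ {P A : Set} {x : A} (d : Dec P) {xs} → P → x ∈ xs → x ∈ whenL d xs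
∈-whenL⁺ (yes _) _ m = m
∈-whenL⁺ (no ¬p) p m = ⊥-elim (¬p p)

∈-unlessL⁺ : ∀ {P A : Set} {x : A} (d : Dec P) {xs} → ¬ P → x ∈ xs → x ∈ unlessL d xs
∈-unlessL⁺ (no _) _ m = m
∈-unlessL⁺ (yes p) ¬p m = ⊥-elim (¬p p)

chains-complete : ∀ p α qs nb B → Unique α → Increasing p α → concat B ↭ α → map st B ≡ reverse qs → All (Increasing p) B →
  AllAdj (NotPrecedes p) (B ++ maybeToList nb) → B ∈ chains p α qs nb
chains-complete p α [] nb [] uα inc B↭α st-B _ _ with PP.↭-empty-inv (↭-sym B↭α)
... | refl = here refl
chains-complete p α [] nb (_ ∷ _) uα inc B↭α () _ _
chains-complete p α (q ∷ qs) nb B uα inc B↭α st-B inc-B adj-B with map-∷ʳ⁻ st B (reverse qs) q (trans st-B (LP.unfold-reverse q qs))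
... | B' , r , refl , st-B' , st-r = ∈-concatSplits⁺ α _ α-split (∈-whenL⁺ (st≟ r q) st-r (∈-unlessL⁺ (precedesMaybe? p r nb) (¬precedes-next nb adj-B) (∈-map⁺ (_++ [ r ]) B'∈)))
  where
  concat-B'∷ʳr : concat (B' ++ [ r ]) ≡ concat B' ++ r
  concat-B'∷ʳr = trans (sym (LP.concat-++ B' [ r ])) (cong (concat B' ++_) (LP.++-identityʳ r))
  B'r↭α : concat B' ++ r ↭ α
  B'r↭α = subst (_↭ α) concat-B'∷ʳr B↭α
  unique-parts = Unique-++⁻ (concat B') (Unique-resp-↭ (↭-sym B'r↭α) uα)
  r⊆α : ∀ {x} → x ∈ r → x ∈ α
  r⊆α m = PP.∈-resp-↭ B'r↭α (∈-++⁺ʳ (concat B') m)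
  rF = filter (_∈? r) α
  lF = filter (¬? ∘ (_∈? r)) α
  inc-r : Increasing p r
  inc-r = All.lookup inc-B (∈-++⁺ʳ B' (here refl))
  filter≡r : rF ≡ r
  filter≡r = sorted-↭⇒≡ (λ a b → ℕP.<-asym a b) (APP.filter⁺ (_∈? r) inc) inc-r
    (same-elements⇒↭ (UP.filter⁺ (_∈? r) uα) (proj₁ (proj₂ unique-parts)) (λ m → proj₂ (∈-filter⁻ (_∈? r) {xs = α} m)) (λ m → ∈-filter⁺ (_∈? r) (r⊆α m) m))
  α-split : Interleaving lF r α
  α-split = subst (λ z → Interleaving lF z α) filter≡r (interleaving-filter r α)
  B'↭lF : concat B' ↭ lF
  B'↭lF = same-elements⇒↭ (proj₁ unique-parts) (UP.filter⁺ (¬? ∘ (_∈? r)) uα)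
     (λ m → ∈-filter⁺ (¬? ∘ (_∈? r)) (PP.∈-resp-↭ B'r↭α (∈-++⁺ˡ m)) (λ mr → proj₂ (proj₂ unique-parts) (m , mr)))
     (λ {x} m → let (mα , nr) = ∈-filter⁻ (¬? ∘ (_∈? r)) m in
        [ (λ mb → mb) , (λ mr → ⊥-elim (nr mr)) ]′ (∈-++⁻ (concat B') (PP.∈-resp-↭ (↭-sym B'r↭α) mα)))
  B'∈ : B' ∈ chains p lF qs (just r)
  B'∈ = chains-complete p lF qs (just r) B' (UP.filter⁺ (¬? ∘ (_∈? r)) uα) (APP.filter⁺ (¬? ∘ (_∈? r)) inc) B'↭lF st-B' (AllP.++⁻ˡ B' inc-B)
         (AllAdj-pre (B' ++ [ r ]) (maybeToList nb) adj-B)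
  ¬precedes-next : ∀ nb → AllAdj (NotPrecedes p) ((B' ++ [ r ]) ++ maybeToList nb) → ¬ PrecedesMaybe p r nb
  ¬precedes-next nothing _ ()
  ¬precedes-next (just s) a = AllAdj-last B' r s a

Disjoint-++ : ∀ {A : Set} {a b c d : List A} → Disjoint a c → Disjoint a d → Disjoint b c → Disjoint b d → Disjoint (a ++ b) (c ++ d)
Disjoint-++ {a = a} {b} {c} {d} h1 h2 h3 h4 (m1 , m2) with ∈-++⁻ a m1 | ∈-++⁻ c m2
... | inj₁ x | inj₁ y = h1 (x , y)
... | inj₁ x | inj₂ y = h2 (x , y)
... | inj₂ x | inj₁ y = h3 (x , y)
... | inj₂ x | inj₂ y = h4 (x , y)

Unique-concatSplits : ∀ {A : Set} w (f : List ℕ → List ℕ → List A) → Unique w → (∀ {l r} → Interleaving l r w → Unique (f l r)) →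
  (∀ {l r l' r'} → Interleaving l r w → Interleaving l' r' w → r ≢ r' → Disjoint (f l r) (f l' r')) → Unique (concatSplits w f)
Unique-concatSplits [] f u unique-f disjoint-f = unique-f []
Unique-concatSplits (y ∷ ys) f (uy ∷ u) unique-f disjoint-f = Unique-concatSplits ys _ u
   (λ i → UP.++⁺ (unique-f (consˡ i)) (unique-f (consʳ i)) (disjoint-f (consˡ i) (consʳ i) (λ e → ℕP.<-irrefl (cong length e) (ℕP.≤-refl))))
   (λ {l} {r} {l'} {r'} i i' ne → Disjoint-++ (disjoint-f (consˡ i) (consˡ i') ne) (disjoint-f (consˡ i) (consʳ i') (λ { refl → y∉r (here refl) i }))
        (disjoint-f (consʳ i) (consˡ i') (λ { refl → y∉r (here refl) i' })) (disjoint-f (consʳ i) (consʳ i') (λ e → ne (proj₂ (LP.∷-injective e)))))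
  where
  y∉r : ∀ {l r} → y ∈ r → Interleaving l r ys → ⊥
  y∉r m i = All.lookup uy (interleaving-∈ʳ i m) refl

chains-unique : ∀ p α qs nb → Unique α → Unique (chains p α qs nb)
chains-unique p [] [] nb u = [] ∷ []
chains-unique p (_ ∷ _) [] nb u = []
chains-unique p α (q ∷ qs) nb u = Unique-concatSplits α _ u unique-step disjoint-steps
  where
  Unique-whenL : ∀ {P : Set} (d : Dec P) {xs : List SetComp} → Unique xs → Unique (whenL d xs)
  Unique-whenL (yes _) x = x
  Unique-whenL (no _) _ = []
  Unique-unlessL : ∀ {P : Set} (d : Dec P) {xs : List SetComp} → Unique xs → Unique (unlessL d xs)
  Unique-unlessL (no _) x = x
  Unique-unlessL (yes _) _ = []
  unique-step : ∀ {l r} → Interleaving l r α → Unique (whenL (st≟ r q) (unlessL (precedesMaybe? p r nb) (map (_++ [ r ]) (chains p l qs (just r)))))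
  unique-step {l} {r} i = Unique-whenL (st≟ r q) (Unique-unlessL (precedesMaybe? p r nb)
    (UP.map⁺ (λ {x} {y} e → proj₁ (LP.∷ʳ-injective x y e)) (chains-unique p l qs (just r) (proj₁ (Unique-interleaving i u)))))
  disjoint-steps : ∀ {l r l' r'} → Interleaving l r α → Interleaving l' r' α → r ≢ r' →
    Disjoint (whenL (st≟ r q) (unlessL (precedesMaybe? p r nb) (map (_++ [ r ]) (chains p l qs (just r))))) (whenL (st≟ r' q) (unlessL (precedesMaybe? p r' nb) (map (_++ [ r' ]) (chains p l' qs (just r')))))
  disjoint-steps {l} {r} {l'} {r'} i i' ne (m1 , m2) with ∈-map⁻ (_++ [ r ]) (proj₂ (∈-unlessL (precedesMaybe? p r nb) _ (proj₂ (∈-whenL (st≟ r q) _ m1))))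
     | ∈-map⁻ (_++ [ r' ]) (proj₂ (∈-unlessL (precedesMaybe? p r' nb) _ (proj₂ (∈-whenL (st≟ r' q) _ m2))))
  ... | X , _ , refl | Y , _ , e = ne (proj₂ (LP.∷ʳ-injective X Y e))

-- Factorisation into irreducible words

least-witness : ∀ (P : ℕ → Set) → (∀ i → Dec (P i)) → ∀ f j → P (j ℕ.+ f) → (∀ i → i < j → ¬ P i) → Σ ℕ λ c → (c ≤ j ℕ.+ f) × P c × (∀ i → i < c → ¬ P i)
least-witness P P? zero j p h = j , ℕP.m≤m+n j 0 , subst P (ℕP.+-identityʳ j) p , h
least-witness P P? (suc f) j p h with P? j
... | yes pj = j , ℕP.m≤m+n j (suc f) , pj , h
... | no ¬pj = let (c , le , pc , hc) = least-witness P P? f (suc j) (subst P (ℕP.+-suc j f) p) h' in c , subst (c ≤_) (sym (ℕP.+-suc j f)) le , pc , hc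
  where
  h' : ∀ i → i < suc j → ¬ P i
  h' i (s≤s le) with ℕP.m≤n⇒m<n∨m≡n le
  ... | inj₁ lt = h i lt
  ... | inj₂ refl = ¬pj

drop-take-++ : ∀ i c (γ : List ℕ) → i ≤ c → drop i γ ≡ drop i (take c γ) ++ drop c γ
drop-take-++ zero c γ _ = sym (LP.take++drop≡id c γ)
drop-take-++ (suc i) (suc c) [] _ = refl
drop-take-++ (suc i) (suc c) (x ∷ γ) (s≤s le) = drop-take-++ i c γ le

drop-length : ∀ (xs : List ℕ) → drop (length xs) xs ≡ []
drop-length [] = refl
drop-length (x ∷ xs) = drop-length xs

-- The first factor of γ ends at the least c > 0 such that every later entry exceeds c.
first-cut : ∀ k γ → γ ↭ range (suc k) →
  Σ ℕ λ c → (0 < c) × (c ≤ suc k) × All (c <_) (drop c γ) × (∀ i → 0 < i → i < c → ¬ All (i <_) (drop i γ))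
first-cut k γ p with least-witness Cut Cut? k 0 cut-at-end (λ _ ())
  where
  Cut : ℕ → Set
  Cut i = All (suc i <_) (drop (suc i) γ)
  Cut? : ∀ i → Dec (Cut i)
  Cut? i = All.all? (λ x → suc i <? x) (drop (suc i) γ)
  cut-at-end : Cut (0 ℕ.+ k)
  cut-at-end = subst (λ z → All (suc k <_) (drop z γ)) (trans (PP.↭-length p) (length-range (suc k)))
    (subst (All (suc k <_)) (sym (drop-length γ)) [])
... | c , c≤k , cut , least = suc c , s≤s z≤n , s≤s c≤k , cut , earlier
  where
  earlier : ∀ i → 0 < i → i < suc c → ¬ All (i <_) (drop i γ)
  earlier (suc i) _ (s≤s i<c) = least i i<c

module _ {n c γ} (p : γ ↭ range n) (c≤n : c ≤ n) (later : All (c <_) (drop c γ)) where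
  private
    uγ : Unique γ
    uγ = Unique-resp-↭ (↭-sym p) (range-unique n)
    c≤γ : c ≤ length γ
    c≤γ = subst (c ≤_) (sym (trans (PP.↭-length p) (length-range n))) c≤n
    γ⊆ : ∀ {x} → x ∈ range c → x ∈ γ
    γ⊆ m = PP.∈-resp-↭ (↭-sym p) (∈-range⁺ (proj₁ (∈-range⁻ m)) (ℕP.≤-trans (proj₂ (∈-range⁻ m)) c≤n))

  length-take-cut : length (take c γ) ≡ c
  length-take-cut = length-take-≤ c γ c≤γ

  take-cut⊆range : ∀ {x} → x ∈ take c γ → x ∈ range c
  take-cut⊆range = length-≤⇒⊇ (range-unique c) range⊆
    (ℕP.≤-reflexive (trans length-take-cut (sym (length-range c))))
    where
    range⊆ : ∀ {x} → x ∈ range c → x ∈ take c γ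
    range⊆ {x} x∈ with ∈-++⁻ (take c γ) (subst (x ∈_) (sym (LP.take++drop≡id c γ)) (γ⊆ x∈))
    ... | inj₁ x∈take = x∈take
    ... | inj₂ x∈drop = ⊥-elim (ℕP.<⇒≱ (All.lookup later x∈drop) (proj₂ (∈-range⁻ x∈)))

  take-cut-irreducible : 0 < c → (∀ i → 0 < i → i < c → ¬ All (i <_) (drop i γ)) → IrreducibleWord (take c γ)
  take-cut-irreducible 0<c earlier =
    (subst (0 <_) (sym length-take-cut) 0<c ,
     All.tabulate (λ m → proj₁ (∈-range⁻ (take-cut⊆range m)) , subst (_ ≤_) (sym length-take-cut) (proj₂ (∈-range⁻ (take-cut⊆range m)))) ,
     (λ i 0<i i< → no-cut i 0<i (subst (i <_) length-take-cut i<))) ,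
    UP.take⁺ c uγ
    where
    no-cut : ∀ i → 0 < i → i < c → Any (_≤ i) (drop i (take c γ))
    no-cut i 0<i i<c with Any⇒∈ (AllP.¬All⇒Any¬ (λ x → i <? x) _ (earlier i 0<i i<c))
    ... | z , z∈ , z≮ with ∈-++⁻ (drop i (take c γ)) (subst (z ∈_) (drop-take-++ i c γ (ℕP.<⇒≤ i<c)) z∈)
    ...   | inj₁ z∈′ = Any.map (λ { refl → ℕP.≮⇒≥ z≮ }) (Any.map sym z∈′)
    ...   | inj₂ z∈″ = ⊥-elim (ℕP.<⇒≱ (All.lookup later z∈″) (ℕP.≤-trans (ℕP.≮⇒≥ z≮) (ℕP.<⇒≤ i<c)))

  drop-cut-↭ : map (_∸ c) (drop c γ) ↭ range (n ∸ c)
  drop-cut-↭ = same-elements⇒↭ unique (range-unique (n ∸ c)) ⊆range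
    (length-≤⇒⊇ unique ⊆range (ℕP.≤-reflexive (trans (length-range (n ∸ c)) (sym length≡))))
    where
    unique : Unique (map (_∸ c) (drop c γ))
    unique = Unique-map⁺ (_∸ c) (UP.drop⁺ c uγ) (λ ma mb e → trans (sym (ℕP.m∸n+n≡m (ℕP.<⇒≤ (All.lookup later ma))))
      (trans (cong (ℕ._+ c) e) (ℕP.m∸n+n≡m (ℕP.<⇒≤ (All.lookup later mb)))))
    ⊆range : ∀ {z} → z ∈ map (_∸ c) (drop c γ) → z ∈ range (n ∸ c)
    ⊆range m with ∈-map⁻ (_∸ c) m
    ... | x , x∈ , refl = ∈-range⁺ (ℕP.m<n⇒0<n∸m (All.lookup later x∈))
      (ℕP.∸-monoˡ-≤ c (proj₂ (∈-range⁻ (PP.∈-resp-↭ p (∈-drop c γ x∈)))))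
    length≡ : length (map (_∸ c) (drop c γ)) ≡ n ∸ c
    length≡ = trans (LP.length-map _ (drop c γ)) (trans (LP.length-drop c γ)
      (cong (_∸ c) (trans (PP.↭-length p) (length-range n))))

  γ≡take·drop : γ ≡ take c γ · map (_∸ c) (drop c γ)
  γ≡take·drop = trans (sym (LP.take++drop≡id c γ)) (cong (take c γ ++_)
    (trans (sym unshift) (cong (λ m → map (ℕ._+ m) (map (_∸ c) (drop c γ))) (sym length-take-cut))))
    where
    unshift : map (ℕ._+ c) (map (_∸ c) (drop c γ)) ≡ drop c γ
    unshift = trans (sym (LP.map-∘ (drop c γ))) (LP.map-id-local (All.map (λ lt → ℕP.m∸n+n≡m (ℕP.<⇒≤ lt)) later))

irreducible-factorisation : ∀ f k γ → k ≤ f → γ ↭ range k → Σ (List (List ℕ)) λ ps → (γ ≡ prod ps) × All IrreducibleWord ps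
irreducible-factorisation f zero γ _ p = [] , PP.↭-empty-inv p , []
irreducible-factorisation zero (suc k) γ () p
irreducible-factorisation (suc f) (suc k) γ (s≤s k≤f) p with first-cut k γ p
... | c , 0<c , c≤ , later , earlier
    with irreducible-factorisation f (suc k ∸ c) _ (ℕP.≤-trans (ℕP.∸-monoʳ-≤ {m = 1} {n = c} (suc k) 0<c) k≤f) (drop-cut-↭ p c≤ later)
... | ps , rest≡ , ips = take c γ ∷ ps , trans (γ≡take·drop p c≤ later) (cong (take c γ ·_) rest≡) ,
                         take-cut-irreducible p c≤ later 0<c earlier ∷ ips

-- Chains versus the words counted by d_{α,γ}

Segment : List ℕ → List ℕ → Set
Segment β c = Σ (List ℕ) λ u → Σ (List ℕ) λ v → β ≡ u ++ c ++ v

Segment-concat : ∀ (Cs : SetComp) → All (Segment (concat Cs)) Cs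
Segment-concat [] = []
Segment-concat (c ∷ Cs) = ([] , concat Cs , refl) ∷ All.map (λ { (u , v , e) → c ++ u , v , trans (cong (c ++_) e) (sym (LP.++-assoc c u _)) }) (Segment-concat Cs)

Before⇒AllPairs : ∀ {R : ℕ → ℕ → Set} (w : List ℕ) → (∀ {x y} → Before w x y → R x y) → AllPairs R w
Before⇒AllPairs [] f = []
Before⇒AllPairs (z ∷ w) f = All.tabulate (λ m → f ([] , w , refl , m)) ∷ Before⇒AllPairs w (λ { (u , v , refl , m) → f (z ∷ u , v , refl , m) })

Segment-unique : ∀ {β c} → Unique β → Segment β c → Unique c
Segment-unique {β} {c} u (a , b , refl) = proj₁ (Unique-++⁻ c (proj₁ (proj₂ (Unique-++⁻ a u))))

Segment-∈ : ∀ {β c x} → Segment β c → x ∈ c → x ∈ β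
Segment-∈ (a , b , refl) m = ∈-++⁺ʳ a (∈-++⁺ˡ m)

Segment-Before : ∀ {β c x y} → Segment β c → Before c x y → Before β x y
Segment-Before (a , b , refl) bf = Before-infix a b bf

blocks-concat : ∀ (Cs : SetComp) ps → map length Cs ≡ map length ps → blocks (concat Cs) ps ≡ Cs
blocks-concat [] [] _ = refl
blocks-concat (c ∷ Cs) (π ∷ ps) e with LP.∷-injective e
... | e1 , e2 = cong₂ _∷_ (trans (cong (λ z → take z (c ++ concat Cs)) (sym e1)) (take-length-++ c (concat Cs)))
    (trans (cong (λ z → blocks (drop z (c ++ concat Cs)) ps) (sym e1)) (trans (cong (λ z → blocks z ps) (drop-length-++ c (concat Cs))) (blocks-concat Cs ps e2)))

concat-injective : ∀ (B B' : SetComp) → map length B ≡ map length B' → concat B ≡ concat B' → B ≡ B'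
concat-injective [] [] _ _ = refl
concat-injective (b ∷ B) (b' ∷ B') e c with LP.∷-injective e
... | e1 , e2 with ++-cancel-length b (concat B) b' (concat B') c e1
... | refl , c2 = cong (b ∷_) (concat-injective B B' e2 c2)

compose-chainWord : ∀ B ps → map st B ≡ ps → All Unique B → All IrreducibleWord ps → compose (concat (map sort B)) (prod ps) ≡ concat B
compose-chainWord [] [] _ _ _ = refl
compose-chainWord (w ∷ B) (π ∷ ps) e (uw ∷ uB) ((iπ , uπ) ∷ ips) with LP.∷-injective e
... | refl , e2 = trans (compose-split (sort w ++ concat (map sort B)) (st w) (prod ps) (irreducible-bounds iπ) (prod-positive ps ips))
   (cong₂ _++_ (trans (cong (λ z → compose (take z (sort w ++ _)) (st w)) lw) (trans (cong (λ z → compose z (st w)) (take-length-++ (sort w) _)) (compose-sort-st uw)))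
               (trans (cong (λ z → compose (drop z (sort w ++ _)) (prod ps)) lw) (trans (cong (λ z → compose z (prod ps)) (drop-length-++ (sort w) _)) (compose-chainWord B ps e2 uB ips))))
  where
  lw : length (st w) ≡ length (sort w)
  lw = trans (length-st w) (sym (PP.↭-length (sort-↭ w)))

concat-sort-↭ : ∀ (B : SetComp) → concat (map sort B) ↭ concat B
concat-sort-↭ [] = ↭-refl
concat-sort-↭ (w ∷ B) = PP.++⁺ (sort-↭ w) (concat-sort-↭ B)

size-st : ∀ (B : SetComp) ps → map st B ≡ ps → size ps ≡ length (concat B)
size-st [] [] _ = refl
size-st (w ∷ B) (π ∷ ps) e with LP.∷-injective e
... | refl , e2 = trans (cong₂ ℕ._+_ (length-st w) (size-st B ps e2)) (sym (LP.length-++ w))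

Unique-concat⁻ : ∀ (B : SetComp) → Unique (concat B) → All Unique B
Unique-concat⁻ [] _ = []
Unique-concat⁻ (w ∷ B) u = proj₁ (Unique-++⁻ w u) ∷ Unique-concat⁻ B (proj₁ (proj₂ (Unique-++⁻ w u)))

AllAdj-Disjoint : ∀ (B : SetComp) → Unique (concat B) → AllAdj Disjoint B
AllAdj-Disjoint [] _ = tt
AllAdj-Disjoint (w ∷ []) _ = tt
AllAdj-Disjoint (w ∷ w' ∷ B) u = (λ { (m1 , m2) → proj₂ (proj₂ (Unique-++⁻ w u)) (m1 , ∈-++⁺ˡ m2) }) , AllAdj-Disjoint (w' ∷ B) (proj₁ (proj₂ (Unique-++⁻ w u)))

AllAdj-zip : ∀ {R S T : List ℕ → List ℕ → Set} (B : SetComp) → AllAdj R B → AllAdj S B → (∀ {a b} → R a b → S a b → T a b) → AllAdj T B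
AllAdj-zip [] _ _ f = tt
AllAdj-zip (w ∷ []) _ _ f = tt
AllAdj-zip (w ∷ w' ∷ B) (r , rs) (s , ss) f = f r s , AllAdj-zip (w' ∷ B) rs ss f

AllAdj-map : ∀ {R T : List ℕ → List ℕ → Set} (g : List ℕ → List ℕ) (B : SetComp) → AllAdj R B → (∀ {a b} → R a b → T (g a) (g b)) → AllAdj T (map g B)
AllAdj-map g [] _ f = tt
AllAdj-map g (w ∷ []) _ f = tt
AllAdj-map g (w ∷ w' ∷ B) (r , rs) f = f r , AllAdj-map g (w' ∷ B) rs f

AllAdj-mono : ∀ {R T : List ℕ → List ℕ → Set} (B : SetComp) → AllAdj R B → (∀ {a b} → R a b → T a b) → AllAdj T B
AllAdj-mono [] _ f = tt
AllAdj-mono (w ∷ []) _ f = tt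
AllAdj-mono (w ∷ w' ∷ B) (r , rs) f = f r , AllAdj-mono (w' ∷ B) rs f

All⇒AllAdj : ∀ {P : List ℕ → Set} (B : SetComp) → All P B → AllAdj (λ a b → P a × P b) B
All⇒AllAdj [] _ = tt
All⇒AllAdj (w ∷ []) _ = tt
All⇒AllAdj (w ∷ w' ∷ B) (p ∷ p' ∷ ps) = (p , p') , All⇒AllAdj (w' ∷ B) (p' ∷ ps)

∈-sort⁺ : ∀ {w x} → x ∈ w → x ∈ sort w
∈-sort⁺ {w} m = PP.∈-resp-↭ (↭-sym (sort-↭ w)) m

∈-sort⁻ : ∀ {w x} → x ∈ sort w → x ∈ w
∈-sort⁻ {w} m = PP.∈-resp-↭ (sort-↭ w) m

Segment-sorted⇒IncEps : ∀ {β c} → Segment β c → AllPairs _<_ c → IncEps β c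
Segment-sorted⇒IncEps sg asc {x} {y} mx my lt with Before-total mx my (ℕP.<⇒≢ lt)
... | inj₁ b = Segment-Before sg b
... | inj₂ b = ⊥-elim (ℕP.<-asym lt (AllPairs-Before asc b))

IncEps⇒sorted : ∀ {β c} → Unique β → Segment β c → IncEps β c → AllPairs _<_ c
IncEps⇒sorted {β} {c} uβ sg inc = Before⇒AllPairs c ordered
  where
  ordered : ∀ {x y} → Before c x y → x < y
  ordered {x} {y} b with ℕP.<-cmp x y
  ... | tri< lt _ _ = lt
  ... | tri≈ _ refl _ = ⊥-elim (ℕP.<-irrefl refl (Before⇒position-< (Segment-unique uβ sg) b))
  ... | tri> _ _ gt = ⊥-elim (Before-asym uβ (Segment-Before sg b) (inc (proj₂ (Before-∈ b)) (proj₁ (Before-∈ b)) gt))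

Segment-Increasing⇒IncAlpha : ∀ {α δ w} → Unique α → Segment δ w → Increasing (position α) w → IncAlpha α δ w
Segment-Increasing⇒IncAlpha uα sg inc mx my bf with Before-total mx my (λ { refl → ℕP.<-irrefl refl (Before⇒position-< uα bf) })
... | inj₁ b = Segment-Before sg b
... | inj₂ b = ⊥-elim (ℕP.<-asym (Before⇒position-< uα bf) (AllPairs-Before inc b))

IncAlpha⇒Increasing : ∀ {α δ d} → Unique δ → (∀ {x} → x ∈ δ → x ∈ α) → Segment δ d → IncAlpha α δ d → Increasing (position α) d
IncAlpha⇒Increasing {α} {δ} {d} uδ δ⊆α sg inc = Before⇒AllPairs d ordered
  where
  ordered : ∀ {x y} → Before d x y → position α x < position α y
  ordered {x} {y} b with ℕP.<-cmp (position α x) (position α y)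
  ... | tri< lt _ _ = lt
  ... | tri≈ _ eq _ = ⊥-elim (ℕP.<-irrefl (cong (position d) (position-injective x∈α y∈α eq)) (Before⇒position-< (Segment-unique uδ sg) b))
    where
    x∈α = δ⊆α (Segment-∈ sg (proj₁ (Before-∈ b)))
    y∈α = δ⊆α (Segment-∈ sg (proj₂ (Before-∈ b)))
  ... | tri> _ _ gt = ⊥-elim (Before-asym uδ (Segment-Before sg b)
          (inc (proj₂ (Before-∈ b)) (proj₁ (Before-∈ b)) (position-<⇒Before (δ⊆α (Segment-∈ sg (proj₂ (Before-∈ b)))) (δ⊆α (Segment-∈ sg (proj₁ (Before-∈ b)))) gt)))

NotPrecedes⇒Cond3 : ∀ {α w w'} → (∀ {x} → x ∈ w → x ∈ α) → (∀ {x} → x ∈ w' → x ∈ α) → Disjoint w w' →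
  NotPrecedes (position α) w w' → Cond3 α (sort w) (sort w')
NotPrecedes⇒Cond3 {α} {w} {w'} w⊆α w'⊆α dj np with Any⇒∈ (AllP.¬All⇒Any¬ (λ x → precedesAll? (position α) x w') _ np)
... | x , mx , nx with Any⇒∈ (AllP.¬All⇒Any¬ (λ y → (position α x <? position α y) ×-dec (x <? y)) _ nx)
... | y , my , ny with x <? y
...   | no x≮y = inj₁ (x , y , ∈-sort⁺ mx , ∈-sort⁺ my , ℕP.≤∧≢⇒< (ℕP.≮⇒≥ x≮y) (λ { refl → dj (mx , my) }))
...   | yes x<y = inj₂ (x , y , ∈-sort⁺ mx , ∈-sort⁺ my , position-<⇒Before (w'⊆α my) (w⊆α mx)
          (ℕP.≤∧≢⇒< (ℕP.≮⇒≥ (λ plt → ny (plt , x<y))) (λ e → ℕP.<⇒≢ x<y (sym (position-injective (w'⊆α my) (w⊆α mx) e)))))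

chain⇒DCond : ∀ n α ps B → α ↭ range n → All IrreducibleWord ps → concat B ↭ α → map st B ≡ ps → All (Increasing (position α)) B → AllAdj (NotPrecedes (position α)) B →
  DCond n α (prod ps) (concat (map sort B))
chain⇒DCond n α ps B wα ips cB eB iB adjB = ↭-trans β↭α wα , map sort B , join , incEps , incAlpha , cond3
  where
  uα = word-unique wα
  uB : Unique (concat B)
  uB = Unique-resp-↭ (↭-sym cB) uα
  β = concat (map sort B)
  β↭α : β ↭ α
  β↭α = ↭-trans (concat-sort-↭ B) cB
  |β| : length β ≡ size ps
  |β| = trans (PP.↭-length (concat-sort-↭ B)) (sym (size-st B ps eB))
  lengths : map length (map sort B) ≡ map length ps
  lengths = trans (sym (LP.map-∘ B)) (trans (LP.map-cong (λ w → trans (PP.↭-length (sort-↭ w)) (sym (length-st w))) B)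
    (trans (LP.map-∘ B) (cong (map length) eB)))
  join : IsJoin β (compose β (prod ps)) (map sort B)
  join = subst (IsJoin β (compose β (prod ps))) (blocks-concat (map sort B) ps lengths)
    (blocks-isJoin β ps (Unique-resp-↭ (↭-sym β↭α) uα) |β| ips)
  incEps : All (IncEps β) (map sort B)
  incEps = All.zipWith (λ (sg , asc) {_} {_} → Segment-sorted⇒IncEps sg asc)
    (Segment-concat (map sort B) , AllP.map⁺ (All.map sort-strict (Unique-concat⁻ B uB)))
  incAlpha : All (IncAlpha α (compose β (prod ps))) (map sort B)
  incAlpha = subst (λ δ → All (IncAlpha α δ) (map sort B)) (sym (compose-chainWord B ps eB (Unique-concat⁻ B uB) ips))
    (AllP.map⁺ (All.zipWith (λ (sg , inc) {_} {_} mx my → Segment-Increasing⇒IncAlpha uα sg inc (∈-sort⁻ mx) (∈-sort⁻ my))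
      (Segment-concat B , iB)))
  B⊆α : All (λ w → ∀ {x} → x ∈ w → x ∈ α) B
  B⊆α = All.map (λ sg {_} m → PP.∈-resp-↭ cB (Segment-∈ sg m)) (Segment-concat B)
  cond3 : AllAdj (Cond3 α) (map sort B)
  cond3 = AllAdj-map sort B (AllAdj-zip B (AllAdj-zip B adjB (AllAdj-Disjoint B uB) _,_) (All⇒AllAdj B B⊆α) _,_)
    (λ ((np , dj) , (w⊆α , w'⊆α)) → NotPrecedes⇒Cond3 w⊆α w'⊆α dj np)

factorBlocks : List ℕ → List (List ℕ) → SetComp
factorBlocks β [] = []
factorBlocks β (π ∷ ps) = compose (take (length π) β) π ∷ factorBlocks (drop (length π) β) ps

concat-factorBlocks : ∀ β ps → All IrreducibleWord ps → concat (factorBlocks β ps) ≡ compose β (prod ps)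
concat-factorBlocks β [] _ = refl
concat-factorBlocks β (π ∷ ps) ((iπ , _) ∷ ips) = trans (cong (_ ++_) (concat-factorBlocks (drop (length π) β) ps ips))
  (sym (compose-split β π (prod ps) (irreducible-bounds iπ) (prod-positive ps ips)))

at-strict : ∀ {c : List ℕ} → AllPairs _<_ c → ∀ {a b} → 1 ≤ a → a < b → b ≤ length c → at c a < at c b
at-strict {z ∷ c} (pz ∷ ap) {suc zero} {suc (suc b)} _ _ (s≤s le) = All.lookup pz (at-∈ c (suc b) (s≤s z≤n) le)
at-strict {z ∷ c} (pz ∷ ap) {suc zero} {suc zero} _ (s≤s ()) _
at-strict {z ∷ c} (pz ∷ ap) {suc (suc a)} {suc (suc b)} _ (s≤s lt) (s≤s le) = at-strict ap (s≤s z≤n) lt le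

factorBlocks-sorted : ∀ β ps → length β ≡ size ps → All IrreducibleWord ps → All (AllPairs _<_) (blocks β ps) →
  Pointwise _↭_ (factorBlocks β ps) (blocks β ps) × (map st (factorBlocks β ps) ≡ ps) × (map sort (factorBlocks β ps) ≡ blocks β ps)
factorBlocks-sorted β [] _ _ _ = [] , refl , refl
factorBlocks-sorted β (π ∷ ps) lβ ((iπ , uπ) ∷ ips) (asc ∷ ascs) with factorBlocks-sorted (drop (length π) β) ps (length-drop-factor β π ps lβ) ips ascs
... | r1 , r2 , r3 = dc ∷ r1 , cong₂ _∷_ sd r2 , cong₂ _∷_ srtd r3
  where
  c = take (length π) β
  d = compose c π
  lc : length c ≡ length π
  lc = length-take-≤ (length π) β (subst (length π ≤_) (sym lβ) (ℕP.m≤m+n _ _))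
  pπ = irreducible-↭-range iπ uπ
  dc : d ↭ c
  dc = compose-perm c π (sym lc) pπ
  bnd : ∀ {a} → a ∈ π → 1 ≤ a × a ≤ length c
  bnd m = let (lo , hi) = All.lookup (irreducible-bounds iπ) m in lo , subst (_ ≤_) (sym lc) hi
  ordp : ∀ {a b} → a ∈ π → b ∈ π → (a < b → at c a < at c b) × (at c a < at c b → a < b)
  ordp {a} {b} ma mb = (λ lt → at-strict asc (proj₁ (bnd ma)) lt (proj₂ (bnd mb))) , back
    where
    back : at c a < at c b → a < b
    back lt with ℕP.<-cmp a b
    ... | tri< x _ _ = x
    ... | tri≈ _ refl _ = ⊥-elim (ℕP.<-irrefl refl lt)
    ... | tri> _ _ x = ⊥-elim (ℕP.<-asym lt (at-strict asc (proj₁ (bnd mb)) x (proj₂ (bnd ma))))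
  sd : st d ≡ π
  sd = trans (st-map-monotone (at c) π ordp) (st-permutation pπ)
  ud : Unique d
  ud = Unique-resp-↭ (↭-sym dc) (AP.map ℕP.<⇒≢ asc)
  srtd : sort d ≡ c
  srtd = sorted-↭⇒≡ (λ a b → ℕP.<-asym a b) (sort-strict ud) asc (↭-trans (sort-↭ d) dc)

Cond3⇒NotPrecedes : ∀ {α a b} → Unique α → Cond3 α a b → NotPrecedes (position α) a b
Cond3⇒NotPrecedes u (inj₁ (x , y , mx , my , lt)) m = ℕP.<-asym lt (proj₂ (All.lookup (All.lookup m mx) my))
Cond3⇒NotPrecedes u (inj₂ (x , y , mx , my , bf)) m = ℕP.<-asym (Before⇒position-< u bf) (proj₁ (All.lookup (All.lookup m mx) my))

-- By join-unique, Λ is blocks β ps; the chain is β ∘ γ cut at the same places.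
DCond⇒chain : ∀ n α ps β → α ↭ range n → All IrreducibleWord ps → prod ps ↭ range n → DCond n α (prod ps) β →
  Σ SetComp λ B → (B ∈ chains (position α) α (reverse ps) nothing) × (concat (map sort B) ≡ β)
DCond⇒chain n α ps β wα ips wγ (wβ , Λ , isJoin , incEps , incAlpha , cond3) = B , B∈chains , B-sorts-to-β
  where
  p = position α
  uα = word-unique wα
  uβ = word-unique wβ
  |γ| : length (prod ps) ≡ n
  |γ| = trans (PP.↭-length wγ) (length-range n)
  |β| : length β ≡ size ps
  |β| = trans (PP.↭-length wβ) (trans (length-range n) (trans (sym |γ|) (length-prod ps)))
  δ = compose β (prod ps)
  C = blocks β ps
  Λ≈C = join-unique β ps uβ |β| ips Λ isJoin
  C-sorted : All (AllPairs _<_) C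
  C-sorted = All.zipWith (λ (sg , inc) → IncEps⇒sorted uβ sg (λ {x} {y} → inc {x} {y}))
    (subst (λ z → All (Segment z) C) (concat-blocks β ps |β|) (Segment-concat C) , Pointwise-All IncEps-↭ Λ≈C incEps)
  B = factorBlocks β ps
  B-facts = factorBlocks-sorted β ps |β| ips C-sorted
  B≈C = proj₁ B-facts
  concat-B : concat B ≡ δ
  concat-B = concat-factorBlocks β ps ips
  δ↭β : δ ↭ β
  δ↭β = compose-perm β (prod ps) (trans (length-prod ps) (sym |β|))
    (subst (λ m → prod ps ↭ range m) (sym |γ|) wγ)
  δ⊆α : ∀ {x} → x ∈ δ → x ∈ α
  δ⊆α = PP.∈-resp-↭ (↭-trans δ↭β (↭-trans wβ (↭-sym wα)))
  B-increasing : All (Increasing p) B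
  B-increasing = All.zipWith (λ (sg , inc) → IncAlpha⇒Increasing (Unique-resp-↭ (↭-sym δ↭β) uβ) δ⊆α sg (λ {x} {y} → inc {x} {y}))
    (subst (λ z → All (Segment z) B) concat-B (Segment-concat B) ,
     Pointwise-All IncAlpha-↭ (Pw.symmetric ↭-sym B≈C) (Pointwise-All IncAlpha-↭ Λ≈C incAlpha))
  B-adjacent : AllAdj (NotPrecedes p) B
  B-adjacent = AllAdj-mono B (Pointwise-AllAdj Cond3-↭ (Pw.symmetric ↭-sym B≈C) (Pointwise-AllAdj Cond3-↭ Λ≈C cond3)) (Cond3⇒NotPrecedes uα)
  B∈chains : B ∈ chains p α (reverse ps) nothing
  B∈chains = chains-complete p α (reverse ps) nothing B uα (Increasing-position α uα)
    (subst (_↭ α) (sym concat-B) (↭-trans δ↭β (↭-trans wβ (↭-sym wα))))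
    (trans (proj₁ (proj₂ B-facts)) (sym (LP.reverse-involutive ps))) B-increasing
    (subst (AllAdj (NotPrecedes p)) (sym (LP.++-identityʳ B)) B-adjacent)
  B-sorts-to-β : concat (map sort B) ≡ β
  B-sorts-to-β = trans (cong concat (proj₂ (proj₂ B-facts))) (concat-blocks β ps |β|)

prodRev-reverse : ∀ ps → prodRev (reverse ps) ≡ prod ps
prodRev-reverse [] = refl
prodRev-reverse (π ∷ ps) = trans (cong prodRev (LP.unfold-reverse π ps)) (trans (prodRev-∷ʳ (reverse ps) π) (cong (π ·_) (prodRev-reverse ps)))

sizeRev-reverse : ∀ ps → sizeRev (reverse ps) ≡ size ps
sizeRev-reverse ps = trans (sym (length-prodRev (reverse ps))) (trans (cong length (prodRev-reverse ps)) (length-prod ps))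

length-blocks : ∀ β ps → length (blocks β ps) ≡ length ps
length-blocks β [] = refl
length-blocks β (π ∷ ps) = cong suc (length-blocks _ ps)

at-map : ∀ (f : ℕ → ℕ) (b : List ℕ) j → 1 ≤ j → j ≤ length b → at (map f b) j ≡ f (at b j)
at-map f (x ∷ b) (suc zero) _ _ = refl
at-map f (x ∷ b) (suc (suc j)) _ (s≤s le) = at-map f b (suc j) (s≤s z≤n) le

at-range : ∀ n j → 1 ≤ j → j ≤ n → at (range n) j ≡ j
at-range (suc n) (suc zero) _ _ = cong (λ z → at z 1) (range-suc n)
at-range (suc n) (suc (suc j)) _ (s≤s le) = trans (cong (λ z → at z (suc (suc j))) (range-suc n))
  (trans (at-map suc (range n) (suc j) (s≤s z≤n) (subst (suc j ≤_) (sym (length-range n)) le)) (cong suc (at-range n (suc j) (s≤s z≤n) le)))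

compose-range : ∀ n γ → All (λ x → 1 ≤ x × x ≤ n) γ → compose (range n) γ ≡ γ
compose-range n γ b = LP.map-id-local (All.map (λ {x} (lo , hi) → at-range n x lo hi) b)

-- The coefficients of the antipode

chainWord : SetComp → List ℕ
chainWord B = concat (map sort B)

module _ {n α} (wα : IsWord n α) {ps} (ips : All IrreducibleWord ps) (wγ : prod ps ↭ range n) where
  private
    uα = word-unique wα
    p = position α

  chainsOf : List SetComp
  chainsOf = chains p α (reverse ps) nothing

  size≡n : size ps ≡ n
  size≡n = trans (sym (length-prod ps)) (trans (PP.↭-length wγ) (length-range n))

  chains-invariant : ∀ {B} → B ∈ chainsOf →
    (concat B ↭ α) × (map st B ≡ ps) × All (Increasing p) B × AllAdj (NotPrecedes p) B
  chains-invariant {B} m with chains-sound p α (reverse ps) nothing B (Increasing-position α uα) m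
  ... | cB , stB , incB , adjB = cB , trans stB (LP.reverse-involutive ps) , incB ,
          subst (AllAdj (NotPrecedes p)) (LP.++-identityʳ B) adjB

  map-length-chains : ∀ {B} → B ∈ chainsOf → map length B ≡ map length ps
  map-length-chains {B} m = trans (LP.map-cong-local (All.tabulate (λ {w} _ → sym (length-st w))))
    (trans (LP.map-∘ B) (cong (map length) (proj₁ (proj₂ (chains-invariant m)))))

  compose-chainWord-chains : ∀ {B} → B ∈ chainsOf → compose (chainWord B) (prod ps) ≡ concat B
  compose-chainWord-chains {B} m = compose-chainWord B ps (proj₁ (proj₂ (chains-invariant m)))
    (Unique-concat⁻ B (Unique-resp-↭ (↭-sym (proj₁ (chains-invariant m))) uα)) ips

  chainWords-unique : Unique (map chainWord chainsOf)
  chainWords-unique = Unique-map⁺ chainWord (chains-unique p α (reverse ps) nothing uα)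
    (λ {B₁} {B₂} m₁ m₂ e → concat-injective B₁ B₂ (trans (map-length-chains m₁) (sym (map-length-chains m₂)))
      (trans (sym (compose-chainWord-chains m₁)) (trans (cong (λ β → compose β (prod ps)) e) (compose-chainWord-chains m₂))))

  ∈-chainWords⇔DCond : ∀ β → (β ∈ map chainWord chainsOf) ⇔ DCond n α (prod ps) β
  ∈-chainWords⇔DCond β = mk⇔ to from
    where
    to : β ∈ map chainWord chainsOf → DCond n α (prod ps) β
    to m with ∈-map⁻ chainWord m
    ... | B , mB , refl = let (cB , stB , incB , adjB) = chains-invariant mB in chain⇒DCond n α ps B wα ips cB stB incB adjB
    from : DCond n α (prod ps) β → β ∈ map chainWord chainsOf
    from dc with DCond⇒chain n α ps β wα ips wγ dc
    ... | B , mB , refl = ∈-map⁺ chainWord mB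

  ε∨prod : IsJoin (ε n) (prod ps) (blocks (range n) ps)
  ε∨prod = subst (λ γ → IsJoin (range n) γ (blocks (range n) ps))
    (compose-range n (prod ps) (All.tabulate (λ m → ∈-range⁻ (PP.∈-resp-↭ wγ m))))
    (blocks-isJoin (range n) ps (range-unique n) (trans (length-range n) (sym size≡n)) ips)

  coeff-antipode-prod : coeff (antipode α) (prod ps) ≡ sgn (length ps) * + length chainsOf
  coeff-antipode-prod = begin
    coeff (antipode α) (prod ps)                          ≡⟨ cong (coeff (antipode α)) (sym (prodRev-reverse ps)) ⟩
    coeff (antipode α) (prodRev (reverse ps))              ≡⟨ coeff-antipodeF-prodRev (length α) α p (reverse ps) ℕP.≤-refl
                                                              (Increasing-position α uα) (PP.All-resp-↭ (↭-sym (PP.↭-reverse ps)) (All.map proj₁ ips))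
                                                              (trans (PP.↭-length wα) (trans (length-range n) (trans (sym size≡n) (sym (sizeRev-reverse ps))))) ⟩
    sgn (length (reverse ps)) * chainCount p α (reverse ps) nothing ≡⟨ cong₂ (λ m c → sgn m * c) (LP.length-reverse ps) (chainCount≡length-chains p α (reverse ps) nothing) ⟩
    sgn (length ps) * + length chainsOf                    ∎
    where open ≡-Reasoning

antipode-coefficient : ∀ {n α} → IsWord n α → ∀ γ → IsWord n γ →
  Σ (List (List ℕ)) λ Bs →
    Unique Bs × (∀ β → (β ∈ Bs) ⇔ DCond n α γ β) ×
    Σ SetComp λ E → IsJoin (ε n) γ E × (coeff (antipode α) γ ≡ sgn (length E) * + (length Bs))
antipode-coefficient {n} wα γ wγ with irreducible-factorisation n n γ ℕP.≤-refl wγ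
... | ps , refl , ips =
  map chainWord (chainsOf wα ips wγ) , chainWords-unique wα ips wγ , ∈-chainWords⇔DCond wα ips wγ ,
  blocks (range n) ps , ε∨prod wα ips wγ ,
  trans (coeff-antipode-prod wα ips wγ)
        (cong₂ (λ m c → sgn m * + c) (sym (length-blocks (range n) ps)) (sym (LP.length-map chainWord (chainsOf wα ips wγ))))

theorem4p9 : (n : ℕ) (α : List ℕ) → IsWord n α →
    (∀ u → ¬ IsWord n u → coeff (antipode α) u ≡ + 0) ×
    (∀ γ → IsWord n γ →
      Σ (List (List ℕ)) λ Bs →
        Unique Bs × (∀ β → (β ∈ Bs) ⇔ DCond n α γ β) ×
        Σ SetComp λ E → IsJoin (ε n) γ E ×
          (coeff (antipode α) γ ≡ sgn (length E) * + (length Bs)))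
theorem4p9 n α wα = coeff-antipode-nonword n α wα , antipode-coefficient wα
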